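{- For $m\geq 2$ and $n\geq 0$, $$X_{L_{m,n}}=\frac{(m-1)!}{(m+n-1)!}X_{K_{m+n}}+\sum_{i=0}^{n-1}\frac{m+i-1}{m(m+1)\cdots(m+i)}X_{K_{m+i}}X_{P_{n-i}}.$$
   Context: All graphs are finite and simple. For a graph $G$ with vertex set $\{v_1,\dots,v_N\}$, the chromatic symmetric function is $X_G=\sum_\kappa x_{\kappa(v_1)}\cdots x_{\kappa(v_N)}$, summed over all proper colourings $\kappa:V\to\{1,2,\dots\}$; $X_\emptyset=1$. $K_m$ is the complete graph on $m$ vertices, $P_n$ the path on $n$ vertices. For $m,n\geq1$ the lollipop graph $L_{m,n}$ is obtained from the disjoint union of $K_m$ and $P_n$ by adding an edge joining a vertex of $K_m$ to an end vertex of $P_n$; conventions $K_0=P_0=L_{0,0}=\emptyset$, $L_{m,0}=K_m$, $L_{0,n}=P_n$. -}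

module Defs where

open import Data.Bool using (Bool; true; false; _∧_; _∨_; not; if_then_else_)
open import Data.Nat using (ℕ; zero; suc; _+_; _*_; _∸_; _!; _<ᵇ_; _≡ᵇ_)
open import Data.Fin using (Fin; toℕ)
import Data.Fin.Properties as FinP
open import Data.List using (List; []; _∷_; concatMap; map; foldr; upTo; allFin; length; filterᵇ)
open import Data.Vec.Functional using (Vector) renaming (_∷_ to _∷ᵥ_)
open import Data.Integer using (+_)
open import Data.Rational using (ℚ; _/_; 0ℚ) renaming (_+_ to _+ℚ_; _*_ to _*ℚ_)
open import Relation.Nullary.Decidable using (⌊_⌋)

record Graph : Set where
  field
    N   : ℕ
    adj : Fin N → Fin N → Bool
open Graph public

dist1 : ℕ → ℕ → Bool
dist1 i j = ((i + 1) ≡ᵇ j) ∨ ((j + 1) ≡ᵇ i)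

K : ℕ → Graph
K m = record { N = m ; adj = λ i j → not (toℕ i ≡ᵇ toℕ j) }

P : ℕ → Graph
P n = record { N = n ; adj = λ i j → dist1 (toℕ i) (toℕ j) }

-- lollipop L_{m,n}: vertices 0..m-1 form K_m, vertices m..m+n-1 form P_n
-- (in this order), plus the edge {m-1, m}.
L : ℕ → ℕ → Graph
L m n = record { N = m + n ; adj = λ i j → adjL (toℕ i) (toℕ j) }
  where
  adjL : ℕ → ℕ → Bool
  adjL i j = ((i <ᵇ m) ∧ (j <ᵇ m) ∧ not (i ≡ᵇ j))
           ∨ (dist1 i j ∧ not ((i <ᵇ m) ∧ (j <ᵇ m)))

-- Formal power series in commuting variables x_0, x_1, ... .
-- A monomial involves only finitely many variables; a monomial in the
-- first k variables is an exponent vector  α : Fin k → ℕ  (x^α = ∏ x_j^{α j}).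
-- A series restricted to the first k variables is its coefficient function.
-- Two series are equal iff all coefficients agree for every k.

Series : ℕ → Set
Series k = Vector ℕ k → ℚ

infixl 6 _⊕_
infixl 7 _⊛_ _⊙_

_⊕_ : ∀ {k} → Series k → Series k → Series k
(f ⊕ g) α = f α +ℚ g α

_⊙_ : ∀ {k} → ℚ → Series k → Series k
(c ⊙ f) α = c *ℚ f α

sumℚ : List ℚ → ℚ
sumℚ = foldr _+ℚ_ 0ℚ

below : ∀ k → Vector ℕ k → List (Vector ℕ k)
below zero    α = (λ ()) ∷ []
below (suc k) α =
  concatMap (λ b → map (λ β → b ∷ᵥ β) (below k (λ j → α (Data.Fin.suc j))))
            (upTo (suc (α Data.Fin.zero)))

_⊛_ : ∀ {k} → Series k → Series k → Series k
_⊛_ {k} f g α = sumℚ (map (λ β → f β *ℚ g (λ j → α j ∸ β j)) (below k α))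

Σ< : ∀ {k} → ℕ → (ℕ → Series k) → Series k
Σ< zero    F α = 0ℚ
Σ< (suc n) F α = Σ< n F α +ℚ F n α

-- The coefficient of x^α (α : Fin k → ℕ) in X_G is the number of proper
-- colourings κ : V → {colours} whose colour class of colour j has size α j
-- (for j < k) and which use no colour ≥ k; i.e. proper κ : V → Fin k with
-- |κ⁻¹(j)| = α j for all j.

allMaps : ∀ N k → List (Fin N → Fin k)
allMaps zero    k = (λ ()) ∷ []
allMaps (suc N) k =
  concatMap (λ c → map (λ κ → c ∷ᵥ κ) (allMaps N k)) (allFin k)

allB : ∀ {n} → (Fin n → Bool) → Bool
allB {n} p = foldr _∧_ true (map p (allFin n))

proper : (G : Graph) → ∀ {k} → (Fin (N G) → Fin k) → Bool
proper G κ = allB (λ u → allB (λ v →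
  not (adj G u v) ∨ not ⌊ κ u FinP.≟ κ v ⌋))

classSize : ∀ {N k} → (Fin N → Fin k) → Fin k → ℕ
classSize κ j = length (filterᵇ (λ v → ⌊ κ v FinP.≟ j ⌋) (allFin _))

hasType : ∀ {N k} → (Fin N → Fin k) → Vector ℕ k → Bool
hasType κ α = allB (λ j → classSize κ j ≡ᵇ α j)

X : (G : Graph) → (k : ℕ) → Series k
X G k α = + length (filterᵇ (λ κ → proper G κ ∧ hasType κ α) (allMaps (N G) k)) / 1

-- Rational numbers a/b (only used with b ≠ 0; b = 0 gives junk 0).
frac : ℕ → ℕ → ℚ
frac a zero    = 0ℚ
frac a (suc b) = + a / suc b

rising : ℕ → ℕ → ℕ
rising m zero    = m
rising m (suc i) = rising m i * (m + suc i)

module Submission where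

-- The argument is the recurrence (m ≥ 1, D = K_m ⊔ P_{n+1})
--   m X_{L_{m,n+1}} = (m-1) X_D + X_{L_{m+1,n}},      X_D = X_{K_m} X_{P_{n+1}},
-- after which the formula follows by induction on n, for all m ≥ 1 at once.  The recurrence is
-- a count of colourings of D: L_{m,n+1} adds to D the edge {m-1, m}, L_{m+1,n} adds all edges {r, m}
-- with r < m; by the symmetry of the clique the number E of colourings of D that give a fixed clique
-- vertex the colour of vertex m does not depend on that vertex, whence #D = #L_{m,n+1} + E and
-- #D = #L_{m+1,n} + m E.

open import Defs
open import Data.Bool using (Bool; true; false; _∧_; _∨_; not; T)
open import Data.Bool.Properties using (∧-comm; ∧-identityʳ; T-∧; T-∨)
open import Data.Nat using (ℕ; zero; suc; NonZero; _+_; _*_; _∸_; _!; _≤_; _<_; _<ᵇ_; _≡ᵇ_; z≤n; s≤s; s≤s⁻¹; _<?_; _≤?_)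
open import Data.Nat.Properties
open import Data.Fin as F using (Fin; toℕ)
import Data.Fin.Properties as FinP
open import Data.List using (List; []; _∷_; map; foldr; concatMap; allFin; length; filterᵇ; _++_; applyUpTo; upTo)
open import Data.List.Properties using (map-tabulate; map-cong; map-applyUpTo)
open import Data.List.Relation.Unary.All using (lookup)
open import Data.List.Relation.Unary.All.Properties using (all⁺; all⁻; tabulate⁺)
open import Data.List.Membership.Propositional.Properties using (∈-allFin)
open import Data.Vec.Functional using (Vector) renaming (_∷_ to _∷ᵥ_)
open import Data.Product using (Σ; _×_; _,_; proj₁; proj₂)
open import Data.Sum using (_⊎_; inj₁; inj₂; [_,_]′)
open import Data.Empty using (⊥; ⊥-elim)
open import Data.Unit using (tt)
open import Relation.Nullary using (¬_; Dec; yes; no)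
open import Relation.Nullary.Decidable using (⌊_⌋; toWitness; fromWitness)
open import Relation.Binary.PropositionalEquality
open import Function using (_∘_; id; Equivalence)
open import Algebra.Properties.CommutativeSemigroup +-commutativeSemigroup using () renaming (interchange to +-interchange)
import Data.Integer as ℤ
import Data.Integer.Properties as ℤP
open import Data.Rational as ℚ using (ℚ; 1ℚ; toℚᵘ)
open import Data.Rational.Solver using (module +-*-Solver)
import Data.Rational.Properties as ℚP
open import Data.Rational.Unnormalised as ℚᵘ using (mkℚᵘ; *≡*)
import Data.Rational.Unnormalised.Properties as ℚᵘP

∑ : {A : Set} → List A → (A → ℕ) → ℕ
∑ xs f = foldr _+_ 0 (map f xs)

∑-cong : {A : Set} (xs : List A) {f g : A → ℕ} → (∀ x → f x ≡ g x) → ∑ xs f ≡ ∑ xs g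
∑-cong [] e = refl
∑-cong (x ∷ xs) e = cong₂ _+_ (e x) (∑-cong xs e)

∑-zero : {A : Set} (xs : List A) → ∑ xs (λ _ → 0) ≡ 0
∑-zero [] = refl
∑-zero (x ∷ xs) = ∑-zero xs

∑-+ : {A : Set} (xs : List A) (f g : A → ℕ) → ∑ xs (λ x → f x + g x) ≡ ∑ xs f + ∑ xs g
∑-+ [] f g = refl
∑-+ (x ∷ xs) f g = trans (cong (f x + g x +_) (∑-+ xs f g)) (+-interchange (f x) (g x) (∑ xs f) (∑ xs g))

∑-*ˡ : {A : Set} (xs : List A) (c : ℕ) (f : A → ℕ) → ∑ xs (λ x → c * f x) ≡ c * ∑ xs f
∑-*ˡ [] c f = sym (*-zeroʳ c)
∑-*ˡ (x ∷ xs) c f = trans (cong (c * f x +_) (∑-*ˡ xs c f)) (sym (*-distribˡ-+ c (f x) (∑ xs f)))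

∑-*ʳ : {A : Set} (xs : List A) (c : ℕ) (f : A → ℕ) → ∑ xs (λ x → f x * c) ≡ ∑ xs f * c
∑-*ʳ xs c f = trans (∑-cong xs (λ x → *-comm (f x) c)) (trans (∑-*ˡ xs c f) (*-comm c _))

∑-++ : {A : Set} (xs ys : List A) (f : A → ℕ) → ∑ (xs ++ ys) f ≡ ∑ xs f + ∑ ys f
∑-++ [] ys f = refl
∑-++ (x ∷ xs) ys f = trans (cong (f x +_) (∑-++ xs ys f)) (sym (+-assoc (f x) _ _))

∑-map : {A B : Set} (h : A → B) (xs : List A) (f : B → ℕ) → ∑ (map h xs) f ≡ ∑ xs (f ∘ h)
∑-map h [] f = refl
∑-map h (x ∷ xs) f = cong (f (h x) +_) (∑-map h xs f)

∑-concatMap : {A B : Set} (h : A → List B) (xs : List A) (f : B → ℕ) →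
  ∑ (concatMap h xs) f ≡ ∑ xs (λ x → ∑ (h x) f)
∑-concatMap h [] f = refl
∑-concatMap h (x ∷ xs) f = trans (∑-++ (h x) (concatMap h xs) f) (cong (∑ (h x) f +_) (∑-concatMap h xs f))

∑-comm : {A B : Set} (xs : List A) (ys : List B) (h : A → B → ℕ) →
  ∑ xs (λ x → ∑ ys (h x)) ≡ ∑ ys (λ y → ∑ xs (λ x → h x y))
∑-comm [] ys h = sym (∑-zero ys)
∑-comm (x ∷ xs) ys h = trans (cong (∑ ys (h x) +_) (∑-comm xs ys h)) (sym (∑-+ ys (h x) _))

𝟙 : Bool → ℕ
𝟙 true = 1
𝟙 false = 0

𝟙-∧ : ∀ a b → 𝟙 (a ∧ b) ≡ 𝟙 a * 𝟙 b
𝟙-∧ true b = sym (+-identityʳ (𝟙 b))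
𝟙-∧ false b = refl

𝟙-split : ∀ a e → 𝟙 a ≡ 𝟙 (a ∧ not e) + 𝟙 (a ∧ e)
𝟙-split true true = refl
𝟙-split true false = refl
𝟙-split false e = refl

𝟙-split-forced : ∀ a g e → (T a → T e → T g) → 𝟙 (a ∧ g) ≡ 𝟙 (a ∧ (g ∧ not e)) + 𝟙 (a ∧ e)
𝟙-split-forced true true e _ = 𝟙-split true e
𝟙-split-forced true false true forced = ⊥-elim (forced tt tt)
𝟙-split-forced true false false _ = refl
𝟙-split-forced false g e _ = refl

length-filter : {A : Set} (p : A → Bool) (xs : List A) → length (filterᵇ p xs) ≡ ∑ xs (𝟙 ∘ p)
length-filter p [] = refl
length-filter p (x ∷ xs) with p x
... | true = cong suc (length-filter p xs)
... | false = length-filter p xs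

bool-ext : ∀ {a b : Bool} → (T a → T b) → (T b → T a) → a ≡ b
bool-ext {true} {true} _ _ = refl
bool-ext {true} {false} f _ = ⊥-elim (f tt)
bool-ext {false} {true} _ g = ⊥-elim (g tt)
bool-ext {false} {false} _ _ = refl

-- Boolean connectives read logically (with the Booleans explicit, which helps inference).
T-not : ∀ {a} → (T a → ⊥) → T (not a)
T-not {true} f = f tt
T-not {false} _ = tt

T-not⁻ : ∀ {a} → T (not a) → T a → ⊥
T-not⁻ {false} _ ()

T-∧⁻ : ∀ {a b} → T (a ∧ b) → T a × T b
T-∧⁻ {a} = Equivalence.to (T-∧ {a})

T-∧⁺ : ∀ {a b} → T a → T b → T (a ∧ b)
T-∧⁺ {a} ta tb = Equivalence.from (T-∧ {a}) (ta , tb)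

T-∨⁻ : ∀ {a b} → T (a ∨ b) → T a ⊎ T b
T-∨⁻ {a} = Equivalence.to (T-∨ {a})

T-∨ˡ : ∀ {a b} → T a → T (a ∨ b)
T-∨ˡ {a} = Equivalence.from (T-∨ {a}) ∘ inj₁

T-∨ʳ : ∀ {a b} → T b → T (a ∨ b)
T-∨ʳ {a} = Equivalence.from (T-∨ {a}) ∘ inj₂

∧-swapʳ : ∀ a b c → ((a ∧ b) ∧ c) ≡ ((a ∧ c) ∧ b)
∧-swapʳ true b c = ∧-comm b c
∧-swapʳ false b c = refl

allB⁻ : ∀ {n} (p : Fin n → Bool) → T (allB p) → ∀ u → T (p u)
allB⁻ {n} p t u = lookup (all⁺ p (allFin n) t) (∈-allFin u)

allB⁺ : ∀ {n} (p : Fin n → Bool) → (∀ u → T (p u)) → T (allB p)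
allB⁺ p f = all⁻ p (tabulate⁺ f)

allB-cong : ∀ {n} {p q : Fin n → Bool} → (∀ u → p u ≡ q u) → allB p ≡ allB q
allB-cong {n} e = cong (foldr _∧_ true) (map-cong e (allFin n))

allB-suc : ∀ {n} (p : Fin (suc n) → Bool) → allB p ≡ (p F.zero ∧ allB (p ∘ F.suc))
allB-suc {n} p = cong (λ xs → p F.zero ∧ foldr _∧_ true xs)
  (trans (map-tabulate F.suc p) (sym (map-tabulate id (p ∘ F.suc))))

Proper : (G : Graph) → ∀ {k} → (Fin (N G) → Fin k) → Set
Proper G κ = ∀ u v → T (adj G u v) → κ u ≢ κ v

proper⁻ : ∀ G {k} (κ : Fin (N G) → Fin k) → T (proper G κ) → Proper G κ
proper⁻ G κ t u v a e with T-∨⁻ (allB⁻ _ (allB⁻ _ t u) v)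
... | inj₁ nadj = T-not⁻ nadj a
... | inj₂ ndiff = T-not⁻ ndiff (fromWitness e)

proper⁺ : ∀ G {k} (κ : Fin (N G) → Fin k) → Proper G κ → T (proper G κ)
proper⁺ G κ P = allB⁺ _ (λ u → allB⁺ _ (λ v → edge-ok u v))
  where
  edge-ok : ∀ u v → T (not (adj G u v) ∨ not ⌊ κ u FinP.≟ κ v ⌋)
  edge-ok u v with adj G u v in eq
  ... | false = tt
  ... | true = T-∨ʳ {false} (T-not (λ t → P u v (subst T (sym eq) tt) (toWitness t)))

proper-ext : ∀ G {k} (κ : Fin (N G) → Fin k) {b : Bool} →
  (Proper G κ → T b) → (T b → Proper G κ) → proper G κ ≡ b
proper-ext G κ f g = bool-ext (f ∘ proper⁻ G κ) (proper⁺ G κ ∘ g)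

∑Fin : ∀ n → (Fin n → ℕ) → ℕ
∑Fin n = ∑ (allFin n)

∑Fin-suc : ∀ n (g : Fin (suc n) → ℕ) → ∑Fin (suc n) g ≡ g F.zero + ∑Fin n (g ∘ F.suc)
∑Fin-suc n g = cong (g F.zero +_)
  (trans (cong (λ xs → foldr _+_ 0 (map g xs)) (sym (map-tabulate id F.suc))) (∑-map F.suc (allFin n) g))

∑Col : ∀ N k → ((Fin N → Fin k) → ℕ) → ℕ
∑Col N k = ∑ (allMaps N k)

∑Col-suc : ∀ N k (f : (Fin (suc N) → Fin k) → ℕ) →
  ∑Col (suc N) k f ≡ ∑Fin k (λ c → ∑Col N k (λ κ → f (c ∷ᵥ κ)))
∑Col-suc N k f = trans (∑-concatMap _ (allFin k) f) (∑-cong (allFin k) (λ c → ∑-map (c ∷ᵥ_) (allMaps N k) f))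

∑Col-cong : ∀ N k {f g : (Fin N → Fin k) → ℕ} → (∀ κ → f κ ≡ g κ) → ∑Col N k f ≡ ∑Col N k g
∑Col-cong N k = ∑-cong (allMaps N k)

count : Graph → (k : ℕ) → Vector ℕ k → ℕ
count G k α = length (filterᵇ (λ κ → proper G κ ∧ hasType κ α) (allMaps (N G) k))

count-∑ : ∀ G k α → count G k α ≡ ∑Col (N G) k (λ κ → 𝟙 (proper G κ ∧ hasType κ α))
count-∑ G k α = length-filter _ (allMaps (N G) k)

classSize-∑ : ∀ {N k} (κ : Fin N → Fin k) j → classSize κ j ≡ ∑Fin N (λ v → 𝟙 ⌊ κ v FinP.≟ j ⌋)
classSize-∑ {N} κ j = length-filter _ (allFin N)

hasType-cong : ∀ {N k} {κ κ' : Fin N → Fin k} → (∀ v → κ v ≡ κ' v) → ∀ α → hasType κ α ≡ hasType κ' α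
hasType-cong {N} {κ = κ} {κ'} e α = allB-cong (λ j → cong (_≡ᵇ α j) (begin
  classSize κ j                          ≡⟨ classSize-∑ κ j ⟩
  ∑Fin N (λ v → 𝟙 ⌊ κ v FinP.≟ j ⌋)     ≡⟨ ∑-cong (allFin N) (λ v → cong (λ c → 𝟙 ⌊ c FinP.≟ j ⌋) (e v)) ⟩
  ∑Fin N (λ v → 𝟙 ⌊ κ' v FinP.≟ j ⌋)    ≡⟨ classSize-∑ κ' j ⟨
  classSize κ' j                         ∎))
  where open ≡-Reasoning

proper-cong : ∀ G {k} {κ κ' : Fin (N G) → Fin k} → (∀ v → κ v ≡ κ' v) → proper G κ ≡ proper G κ'
proper-cong G {κ = κ} {κ'} e = proper-ext G κ (proper⁺ G κ' ∘ transport e) (transport (sym ∘ e) ∘ proper⁻ G κ')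
  where
  transport : ∀ {κ₁ κ₂ : Fin (N G) → Fin _} → (∀ v → κ₁ v ≡ κ₂ v) → Proper G κ₁ → Proper G κ₂
  transport e P u v a eq = P u v a (trans (e u) (trans eq (sym (e v))))

-- Exponent vectors: the Boolean test  s = β  pointwise, and the convolution identity behind
-- the product of series: among the β ≤ α, exactly one splits α as s + t with s = β, t = α - β,
-- and only when s + t = α.

sameVec : ∀ {k} → Vector ℕ k → Vector ℕ k → Bool
sameVec s β = allB (λ j → s j ≡ᵇ β j)

sum-applyUpTo-zero : ∀ r → foldr _+_ 0 (applyUpTo (λ _ → 0) r) ≡ 0
sum-applyUpTo-zero zero = refl
sum-applyUpTo-zero (suc r) = sum-applyUpTo-zero r

sum-pick : ∀ r s (G : ℕ → ℕ) → foldr _+_ 0 (applyUpTo (λ b → 𝟙 (s ≡ᵇ b) * G b) r) ≡ 𝟙 (s <ᵇ r) * G s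
sum-pick zero s G = refl
sum-pick (suc r) zero G = trans (cong (G 0 + 0 +_) (sum-applyUpTo-zero r)) (+-identityʳ _)
sum-pick (suc r) (suc s) G = sum-pick r s (G ∘ suc)

upTo-convolution : ∀ a s t → ∑ (upTo (suc a)) (λ b → 𝟙 (s ≡ᵇ b) * 𝟙 (t ≡ᵇ a ∸ b)) ≡ 𝟙 (s + t ≡ᵇ a)
upTo-convolution a s t =
  trans (cong (foldr _+_ 0) (map-applyUpTo id _ (suc a))) (trans (sum-pick (suc a) s (λ b → 𝟙 (t ≡ᵇ a ∸ b))) (split (s ≤? a)))
  where
  split : Dec (s ≤ a) → 𝟙 (s <ᵇ suc a) * 𝟙 (t ≡ᵇ a ∸ s) ≡ 𝟙 (s + t ≡ᵇ a)
  split (yes s≤a) rewrite bool-ext {s <ᵇ suc a} {true} (λ _ → tt) (λ _ → <⇒<ᵇ (s≤s s≤a)) =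
    trans (+-identityʳ _) (cong 𝟙 (bool-ext
      (λ t≡ → ≡⇒≡ᵇ _ _ (trans (cong (s +_) (≡ᵇ⇒≡ _ _ t≡)) (m+[n∸m]≡n s≤a)))
      (λ s+t≡ → ≡⇒≡ᵇ _ _ (sym (trans (cong (_∸ s) (sym (≡ᵇ⇒≡ _ _ s+t≡))) (m+n∸m≡n s t))))))
  split (no s≰a)
    rewrite bool-ext {s <ᵇ suc a} {false} (λ lt → s≰a (≤-pred (<ᵇ⇒< _ _ lt))) (λ ())
          | bool-ext {s + t ≡ᵇ a} {false} (λ eq → s≰a (≤-trans (m≤m+n s t) (≤-reflexive (≡ᵇ⇒≡ _ _ eq)))) (λ ())
          = refl

below-convolution : ∀ k (α s t : Vector ℕ k) →
  ∑ (below k α) (λ β → 𝟙 (sameVec s β) * 𝟙 (sameVec t (λ j → α j ∸ β j))) ≡ 𝟙 (sameVec (λ j → s j + t j) α)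
below-convolution zero α s t = refl
below-convolution (suc k) α s t = begin
    ∑ (below (suc k) α) F
  ≡⟨ ∑-concatMap (λ b → map (b ∷ᵥ_) (below k α')) (upTo (suc a₀)) F ⟩
    ∑ (upTo (suc a₀)) (λ b → ∑ (map (b ∷ᵥ_) (below k α')) F)
  ≡⟨ ∑-cong (upTo (suc a₀)) (λ b → trans (∑-map (b ∷ᵥ_) (below k α') F) (∑-cong (below k α') (F-∷ b))) ⟩
    ∑ (upTo (suc a₀)) (λ b → ∑ (below k α') (λ β → F₀ b * F' β))
  ≡⟨ ∑-cong (upTo (suc a₀)) (λ b → ∑-*ˡ (below k α') (F₀ b) F') ⟩
    ∑ (upTo (suc a₀)) (λ b → F₀ b * ∑ (below k α') F')
  ≡⟨ ∑-*ʳ (upTo (suc a₀)) _ F₀ ⟩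
    ∑ (upTo (suc a₀)) F₀ * ∑ (below k α') F'
  ≡⟨ cong₂ _*_ (upTo-convolution a₀ (s F.zero) (t F.zero)) (below-convolution k α' s' t') ⟩
    𝟙 (s F.zero + t F.zero ≡ᵇ a₀) * 𝟙 (sameVec (λ j → s' j + t' j) α')
  ≡⟨ 𝟙-∧ (s F.zero + t F.zero ≡ᵇ a₀) (sameVec (λ j → s' j + t' j) α') ⟨
    𝟙 ((s F.zero + t F.zero ≡ᵇ a₀) ∧ sameVec (λ j → s' j + t' j) α')
  ≡⟨ cong 𝟙 (allB-suc (λ j → s j + t j ≡ᵇ α j)) ⟨
    𝟙 (sameVec (λ j → s j + t j) α) ∎
  where
  open ≡-Reasoning
  a₀ = α F.zero
  α' s' t' : Vector ℕ k
  α' = α ∘ F.suc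
  s' = s ∘ F.suc
  t' = t ∘ F.suc
  F : Vector ℕ (suc k) → ℕ
  F β = 𝟙 (sameVec s β) * 𝟙 (sameVec t (λ j → α j ∸ β j))
  F₀ : ℕ → ℕ
  F₀ b = 𝟙 (s F.zero ≡ᵇ b) * 𝟙 (t F.zero ≡ᵇ a₀ ∸ b)
  F' : Vector ℕ k → ℕ
  F' β = 𝟙 (sameVec s' β) * 𝟙 (sameVec t' (λ j → α' j ∸ β j))
  F-∷ : ∀ b β → F (b ∷ᵥ β) ≡ F₀ b * F' β
  F-∷ b β rewrite allB-suc (λ j → s j ≡ᵇ (b ∷ᵥ β) j) | allB-suc (λ j → t j ≡ᵇ α j ∸ (b ∷ᵥ β) j) =
    interchange (s F.zero ≡ᵇ b) (sameVec s' β) (t F.zero ≡ᵇ a₀ ∸ b) (sameVec t' (λ j → α' j ∸ β j))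
    where
    interchange : ∀ x y x' y' → 𝟙 (x ∧ y) * 𝟙 (x' ∧ y') ≡ (𝟙 x * 𝟙 x') * (𝟙 y * 𝟙 y')
    interchange true y true y' = sym (+-identityʳ _)
    interchange true y false y' = *-zeroʳ (𝟙 y)
    interchange false y x' y' = refl

append : ∀ {a b k} → (Fin a → Fin k) → (Fin b → Fin k) → Fin (a + b) → Fin k
append {zero} κ₁ κ₂ = κ₂
append {suc a} κ₁ κ₂ = κ₁ F.zero ∷ᵥ append (κ₁ ∘ F.suc) κ₂

append-↑ˡ : ∀ {a b k} (κ₁ : Fin a → Fin k) (κ₂ : Fin b → Fin k) i → append κ₁ κ₂ (i F.↑ˡ b) ≡ κ₁ i
append-↑ˡ κ₁ κ₂ F.zero = refl
append-↑ˡ κ₁ κ₂ (F.suc i) = append-↑ˡ (κ₁ ∘ F.suc) κ₂ i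

append-↑ʳ : ∀ {a b k} (κ₁ : Fin a → Fin k) (κ₂ : Fin b → Fin k) j → append κ₁ κ₂ (a F.↑ʳ j) ≡ κ₂ j
append-↑ʳ {zero} κ₁ κ₂ j = refl
append-↑ʳ {suc a} κ₁ κ₂ j = append-↑ʳ (κ₁ ∘ F.suc) κ₂ j

∑Col-append : ∀ a b k (f : (Fin (a + b) → Fin k) → ℕ) →
  ∑Col (a + b) k f ≡ ∑Col a k (λ κ₁ → ∑Col b k (λ κ₂ → f (append κ₁ κ₂)))
∑Col-append zero b k f = sym (+-identityʳ _)
∑Col-append (suc a) b k f = trans (∑Col-suc (a + b) k f)
  (trans (∑-cong (allFin k) (λ c → ∑Col-append a b k (λ κ → f (c ∷ᵥ κ)))) (sym (∑Col-suc a k _)))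

∑Fin-append : ∀ a b {k} (κ₁ : Fin a → Fin k) (κ₂ : Fin b → Fin k) (h : Fin k → ℕ) →
  ∑Fin (a + b) (h ∘ append κ₁ κ₂) ≡ ∑Fin a (h ∘ κ₁) + ∑Fin b (h ∘ κ₂)
∑Fin-append zero b κ₁ κ₂ h = refl
∑Fin-append (suc a) b κ₁ κ₂ h = begin
  ∑Fin (suc a + b) (h ∘ append κ₁ κ₂)                        ≡⟨ ∑Fin-suc (a + b) _ ⟩
  h (κ₁ F.zero) + ∑Fin (a + b) (h ∘ append (κ₁ ∘ F.suc) κ₂)  ≡⟨ cong (h (κ₁ F.zero) +_) (∑Fin-append a b (κ₁ ∘ F.suc) κ₂ h) ⟩
  h (κ₁ F.zero) + (∑Fin a (h ∘ κ₁ ∘ F.suc) + ∑Fin b (h ∘ κ₂)) ≡⟨ +-assoc (h (κ₁ F.zero)) _ _ ⟨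
  h (κ₁ F.zero) + ∑Fin a (h ∘ κ₁ ∘ F.suc) + ∑Fin b (h ∘ κ₂)   ≡⟨ cong (_+ ∑Fin b (h ∘ κ₂)) (∑Fin-suc a (h ∘ κ₁)) ⟨
  ∑Fin (suc a) (h ∘ κ₁) + ∑Fin b (h ∘ κ₂)                    ∎
  where open ≡-Reasoning

classSize-append : ∀ {a b k} (κ₁ : Fin a → Fin k) (κ₂ : Fin b → Fin k) j →
  classSize (append κ₁ κ₂) j ≡ classSize κ₁ j + classSize κ₂ j
classSize-append {a} {b} κ₁ κ₂ j = trans (classSize-∑ (append κ₁ κ₂) j)
  (trans (∑Fin-append a b κ₁ κ₂ (λ c → 𝟙 ⌊ c FinP.≟ j ⌋)) (sym (cong₂ _+_ (classSize-∑ κ₁ j) (classSize-∑ κ₂ j))))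

-- The transposition  τ p  of the vertices p and p + 1 (the identity when p + 1 is out of range).
-- Sums over vertices and over colourings are invariant under relabelling by τ p.

τ : ℕ → ∀ {N} → Fin N → Fin N
τ zero {suc (suc N)} F.zero = F.suc F.zero
τ zero {suc (suc N)} (F.suc F.zero) = F.zero
τ zero {suc (suc N)} (F.suc (F.suc i)) = F.suc (F.suc i)
τ zero {suc zero} F.zero = F.zero
τ (suc p) {suc N} F.zero = F.zero
τ (suc p) {suc N} (F.suc i) = F.suc (τ p i)

τ-involutive : ∀ p {N} (v : Fin N) → τ p (τ p v) ≡ v
τ-involutive zero {suc (suc N)} F.zero = refl
τ-involutive zero {suc (suc N)} (F.suc F.zero) = refl
τ-involutive zero {suc (suc N)} (F.suc (F.suc i)) = refl
τ-involutive zero {suc zero} F.zero = refl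
τ-involutive (suc p) {suc N} F.zero = refl
τ-involutive (suc p) {suc N} (F.suc i) = cong F.suc (τ-involutive p i)

∑Fin-τ : ∀ N p (g : Fin N → ℕ) → ∑Fin N (g ∘ τ p) ≡ ∑Fin N g
∑Fin-τ zero p g = refl
∑Fin-τ (suc zero) zero g = refl
∑Fin-τ (suc (suc N)) zero g = begin
    ∑Fin (suc (suc N)) (g ∘ τ 0)     ≡⟨ ∑Fin-suc (suc N) (g ∘ τ 0) ⟩
    g₁ + ∑Fin (suc N) (g ∘ τ 0 ∘ F.suc) ≡⟨ cong (g₁ +_) (∑Fin-suc N (g ∘ τ 0 ∘ F.suc)) ⟩
    g₁ + (g₀ + R)                    ≡⟨ +-assoc g₁ g₀ R ⟨
    g₁ + g₀ + R                      ≡⟨ cong (_+ R) (+-comm g₁ g₀) ⟩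
    g₀ + g₁ + R                      ≡⟨ +-assoc g₀ g₁ R ⟩
    g₀ + (g₁ + R)                    ≡⟨ cong (g₀ +_) (∑Fin-suc N (g ∘ F.suc)) ⟨
    g₀ + ∑Fin (suc N) (g ∘ F.suc)     ≡⟨ ∑Fin-suc (suc N) g ⟨
    ∑Fin (suc (suc N)) g             ∎
  where
  open ≡-Reasoning
  g₀ = g F.zero
  g₁ = g (F.suc F.zero)
  R = ∑Fin N (g ∘ F.suc ∘ F.suc)
∑Fin-τ (suc N) (suc p) g =
  trans (∑Fin-suc N _) (trans (cong (g F.zero +_) (∑Fin-τ N p (g ∘ F.suc))) (sym (∑Fin-suc N g)))

-- Summands are functions of colourings; we need them to respect pointwise equality,
-- since relabelling only produces pointwise-equal colourings.
Extensional : ∀ {N k} → ((Fin N → Fin k) → ℕ) → Set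
Extensional f = ∀ κ κ' → (∀ v → κ v ≡ κ' v) → f κ ≡ f κ'

∑Col-τ : ∀ N k p (f : (Fin N → Fin k) → ℕ) → Extensional f → ∑Col N k (λ κ → f (κ ∘ τ p)) ≡ ∑Col N k f
∑Col-τ zero k p f ext = ∑Col-cong zero k (λ κ → ext (κ ∘ τ p) κ (λ ()))
∑Col-τ (suc zero) k zero f ext = ∑Col-cong (suc zero) k (λ κ → ext _ _ (λ { F.zero → refl }))
∑Col-τ (suc (suc N)) k zero f ext = begin
    ∑Col (suc (suc N)) k (λ κ → f (κ ∘ τ 0))
  ≡⟨ trans (∑Col-suc (suc N) k _) (∑-cong (allFin k) (λ c → ∑Col-suc N k _)) ⟩
    ∑Fin k (λ c → ∑Fin k (λ d → ∑Col N k (λ κ → f ((c ∷ᵥ d ∷ᵥ κ) ∘ τ 0))))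
  ≡⟨ ∑-cong (allFin k) (λ c → ∑-cong (allFin k) (λ d → ∑Col-cong N k (λ κ → ext _ _ swapped))) ⟩
    ∑Fin k (λ c → ∑Fin k (λ d → ∑Col N k (λ κ → f (d ∷ᵥ c ∷ᵥ κ))))
  ≡⟨ ∑-comm (allFin k) (allFin k) _ ⟩
    ∑Fin k (λ d → ∑Fin k (λ c → ∑Col N k (λ κ → f (d ∷ᵥ c ∷ᵥ κ))))
  ≡⟨ trans (∑Col-suc (suc N) k _) (∑-cong (allFin k) (λ c → ∑Col-suc N k _)) ⟨
    ∑Col (suc (suc N)) k f
  ∎
  where
  open ≡-Reasoning
  swapped : ∀ {c d κ} v → ((c ∷ᵥ d ∷ᵥ κ) ∘ τ 0) v ≡ (d ∷ᵥ c ∷ᵥ κ) v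
  swapped F.zero = refl
  swapped (F.suc F.zero) = refl
  swapped (F.suc (F.suc i)) = refl
∑Col-τ (suc N) k (suc p) f ext = begin
    ∑Col (suc N) k (λ κ → f (κ ∘ τ (suc p)))
  ≡⟨ ∑Col-suc N k _ ⟩
    ∑Fin k (λ c → ∑Col N k (λ κ → f ((c ∷ᵥ κ) ∘ τ (suc p))))
  ≡⟨ ∑-cong (allFin k) (λ c → ∑Col-cong N k (λ κ → ext _ _ λ { F.zero → refl ; (F.suc i) → refl })) ⟩
    ∑Fin k (λ c → ∑Col N k (λ κ → f (c ∷ᵥ (κ ∘ τ p))))
  ≡⟨ ∑-cong (allFin k) (λ c → ∑Col-τ N k p (λ κ → f (c ∷ᵥ κ)) (λ κ κ' e → ext _ _ λ { F.zero → refl ; (F.suc i) → e i })) ⟩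
    ∑Fin k (λ c → ∑Col N k (λ κ → f (c ∷ᵥ κ)))
  ≡⟨ ∑Col-suc N k f ⟨
    ∑Col (suc N) k f
  ∎
  where open ≡-Reasoning

τℕ : ℕ → ℕ → ℕ
τℕ zero zero = 1
τℕ zero (suc zero) = 0
τℕ zero (suc (suc i)) = suc (suc i)
τℕ (suc p) zero = zero
τℕ (suc p) (suc i) = suc (τℕ p i)

toℕ-τ : ∀ p {N} (v : Fin N) → suc p < N → toℕ (τ p v) ≡ τℕ p (toℕ v)
toℕ-τ zero {suc (suc N)} F.zero _ = refl
toℕ-τ zero {suc (suc N)} (F.suc F.zero) _ = refl
toℕ-τ zero {suc (suc N)} (F.suc (F.suc i)) _ = refl
toℕ-τ zero {suc zero} F.zero (s≤s ())
toℕ-τ (suc p) {suc N} F.zero _ = refl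
toℕ-τ (suc p) {suc N} (F.suc i) h = cong suc (toℕ-τ p i (s≤s⁻¹ h))

τℕ-involutive : ∀ p i → τℕ p (τℕ p i) ≡ i
τℕ-involutive zero zero = refl
τℕ-involutive zero (suc zero) = refl
τℕ-involutive zero (suc (suc i)) = refl
τℕ-involutive (suc p) zero = refl
τℕ-involutive (suc p) (suc i) = cong suc (τℕ-involutive p i)

τℕ-< : ∀ p i m → suc p < m → i < m → τℕ p i < m
τℕ-< zero zero m h _ = h
τℕ-< zero (suc zero) m h _ = <-trans (s≤s z≤n) h
τℕ-< zero (suc (suc i)) m _ l = l
τℕ-< (suc p) zero m _ l = l
τℕ-< (suc p) (suc i) (suc m) h l = s≤s (τℕ-< p i m (≤-pred h) (≤-pred l))

τℕ-fix : ∀ p i → suc p < i → τℕ p i ≡ i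
τℕ-fix zero (suc zero) (s≤s ())
τℕ-fix zero (suc (suc i)) _ = refl
τℕ-fix (suc p) (suc i) h = cong suc (τℕ-fix p i (≤-pred h))

τℕ-p : ∀ p → τℕ p (suc p) ≡ p
τℕ-p zero = refl
τℕ-p (suc p) = cong suc (τℕ-p p)

Adjacent : ℕ → ℕ → Set
Adjacent i j = suc i ≡ j ⊎ suc j ≡ i

dist1⁻ : ∀ i j → T (dist1 i j) → Adjacent i j
dist1⁻ i j t with T-∨⁻ t
... | inj₁ e = inj₁ (trans (+-comm 1 i) (≡ᵇ⇒≡ _ _ e))
... | inj₂ e = inj₂ (trans (+-comm 1 j) (≡ᵇ⇒≡ _ _ e))

dist1⁺ : ∀ i j → Adjacent i j → T (dist1 i j)
dist1⁺ i j (inj₁ e) = T-∨ˡ (≡⇒≡ᵇ _ _ (trans (+-comm i 1) e))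
dist1⁺ i j (inj₂ e) = T-∨ʳ {(i + 1) ≡ᵇ j} (≡⇒≡ᵇ _ _ (trans (+-comm j 1) e))

Adjacent-sym : ∀ {i j} → Adjacent i j → Adjacent j i
Adjacent-sym (inj₁ e) = inj₂ e
Adjacent-sym (inj₂ e) = inj₁ e

Adjacent-irrefl : ∀ {i} → ¬ Adjacent i i
Adjacent-irrefl (inj₁ e) = 1+n≢n e
Adjacent-irrefl (inj₂ e) = 1+n≢n e

Adjacent-≤ : ∀ {i j} → Adjacent i j → j ≤ suc i
Adjacent-≤ (inj₁ refl) = ≤-refl
Adjacent-≤ {j = j} (inj₂ refl) = m≤n+m j 2

Adjacent-+ : ∀ a {i j} → Adjacent i j → Adjacent (a + i) (a + j)
Adjacent-+ a {i} (inj₁ e) = inj₁ (trans (sym (+-suc a i)) (cong (a +_) e))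
Adjacent-+ a {j = j} (inj₂ e) = inj₂ (trans (sym (+-suc a j)) (cong (a +_) e))

Adjacent-+⁻ : ∀ a {i j} → Adjacent (a + i) (a + j) → Adjacent i j
Adjacent-+⁻ a {i} (inj₁ e) = inj₁ (+-cancelˡ-≡ a _ _ (trans (+-suc a i) e))
Adjacent-+⁻ a {j = j} (inj₂ e) = inj₂ (+-cancelˡ-≡ a _ _ (trans (+-suc a j) e))

CliqueEdge TailEdge LollipopPathEdge : ℕ → ℕ → ℕ → Set
CliqueEdge m i j = i < m × j < m × i ≢ j
TailEdge m i j = Adjacent i j × m ≤ i × m ≤ j
LollipopPathEdge m i j = Adjacent i j × ¬ (i < m × j < m)

-- The disjoint union  K_a ⊔ P_b : vertices 0..a-1 form the clique, a..a+b-1 the path.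
adjKP : ℕ → ℕ → ℕ → Bool
adjKP a i j = ((i <ᵇ a) ∧ (j <ᵇ a) ∧ not (i ≡ᵇ j)) ∨ (dist1 i j ∧ not (i <ᵇ a) ∧ not (j <ᵇ a))

KP : ℕ → ℕ → Graph
KP a b = record { N = a + b ; adj = λ u v → adjKP a (toℕ u) (toℕ v) }

adjLollipop : ℕ → ℕ → ℕ → Bool
adjLollipop m i j = ((i <ᵇ m) ∧ (j <ᵇ m) ∧ not (i ≡ᵇ j)) ∨ (dist1 i j ∧ not ((i <ᵇ m) ∧ (j <ᵇ m)))

Lollipop : ℕ → ℕ → Graph
Lollipop m N = record { N = N ; adj = λ u v → adjLollipop m (toℕ u) (toℕ v) }

≮ᵇ⇒≥ : ∀ {i m} → T (not (i <ᵇ m)) → m ≤ i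
≮ᵇ⇒≥ t = ≮⇒≥ (λ lt → T-not⁻ t (<⇒<ᵇ lt))

≥⇒≮ᵇ : ∀ {i m} → m ≤ i → T (not (i <ᵇ m))
≥⇒≮ᵇ le = T-not (λ t → <⇒≱ (<ᵇ⇒< _ _ t) le)

clique-test⁻ : ∀ m i j → T ((i <ᵇ m) ∧ (j <ᵇ m) ∧ not (i ≡ᵇ j)) → CliqueEdge m i j
clique-test⁻ m i j t with T-∧⁻ t
... | i<m , t' with T-∧⁻ t'
... | j<m , i≢j = <ᵇ⇒< _ _ i<m , <ᵇ⇒< _ _ j<m , λ e → T-not⁻ i≢j (≡⇒≡ᵇ _ _ e)

clique-test⁺ : ∀ m i j → CliqueEdge m i j → T ((i <ᵇ m) ∧ (j <ᵇ m) ∧ not (i ≡ᵇ j))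
clique-test⁺ m i j (i<m , j<m , i≢j) =
  T-∧⁺ (<⇒<ᵇ i<m) (T-∧⁺ (<⇒<ᵇ j<m) (T-not (λ t → i≢j (≡ᵇ⇒≡ _ _ t))))

adjKP⁻ : ∀ a i j → T (adjKP a i j) → CliqueEdge a i j ⊎ TailEdge a i j
adjKP⁻ a i j t with T-∨⁻ t
... | inj₁ c = inj₁ (clique-test⁻ a i j c)
... | inj₂ p with T-∧⁻ p
... | d , p' with T-∧⁻ p'
... | i≥a , j≥a = inj₂ (dist1⁻ i j d , ≮ᵇ⇒≥ i≥a , ≮ᵇ⇒≥ {j} j≥a)

adjKP⁺ : ∀ a i j → CliqueEdge a i j ⊎ TailEdge a i j → T (adjKP a i j)
adjKP⁺ a i j (inj₁ c) = T-∨ˡ (clique-test⁺ a i j c)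
adjKP⁺ a i j (inj₂ (d , i≥a , j≥a)) =
  T-∨ʳ {(i <ᵇ a) ∧ (j <ᵇ a) ∧ not (i ≡ᵇ j)} (T-∧⁺ (dist1⁺ i j d) (T-∧⁺ (≥⇒≮ᵇ i≥a) (≥⇒≮ᵇ j≥a)))

adjLollipop⁻ : ∀ m i j → T (adjLollipop m i j) → CliqueEdge m i j ⊎ LollipopPathEdge m i j
adjLollipop⁻ m i j t with T-∨⁻ t
... | inj₁ c = inj₁ (clique-test⁻ m i j c)
... | inj₂ p with T-∧⁻ p
... | d , nc = inj₂ (dist1⁻ i j d , λ (i<m , j<m) → T-not⁻ nc (T-∧⁺ (<⇒<ᵇ i<m) (<⇒<ᵇ j<m)))

adjLollipop⁺ : ∀ m i j → CliqueEdge m i j ⊎ LollipopPathEdge m i j → T (adjLollipop m i j)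
adjLollipop⁺ m i j (inj₁ c) = T-∨ˡ (clique-test⁺ m i j c)
adjLollipop⁺ m i j (inj₂ (d , nc)) = T-∨ʳ {(i <ᵇ m) ∧ (j <ᵇ m) ∧ not (i ≡ᵇ j)}
  (T-∧⁺ (dist1⁺ i j d) (T-not (λ t → let (i<m , j<m) = T-∧⁻ t in nc (<ᵇ⇒< _ _ i<m , <ᵇ⇒< _ _ j<m))))

module _ (a b : ℕ) where
  private
    clique-index : ∀ (i : Fin a) → toℕ (i F.↑ˡ b) < a
    clique-index i = subst (_< a) (sym (FinP.toℕ-↑ˡ i b)) (FinP.toℕ<n i)
    path-index : ∀ (j : Fin b) → a ≤ toℕ (a F.↑ʳ j)
    path-index j = subst (a ≤_) (sym (FinP.toℕ-↑ʳ a j)) (m≤m+n a (toℕ j))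

  KP-adj-clique : ∀ i j → adj (KP a b) (i F.↑ˡ b) (j F.↑ˡ b) ≡ adj (K a) i j
  KP-adj-clique i j = bool-ext to from
    where
    i′ = toℕ (i F.↑ˡ b)
    j′ = toℕ (j F.↑ˡ b)
    to : T (adjKP a i′ j′) → T (adj (K a) i j)
    to t with adjKP⁻ a i′ j′ t
    ... | inj₁ (_ , _ , ne) = T-not (λ eq → ne (trans (FinP.toℕ-↑ˡ i b) (trans (≡ᵇ⇒≡ _ _ eq) (sym (FinP.toℕ-↑ˡ j b)))))
    ... | inj₂ (_ , a≤i , _) = ⊥-elim (<⇒≱ (clique-index i) a≤i)
    from : T (adj (K a) i j) → T (adjKP a i′ j′)
    from t = adjKP⁺ a i′ j′ (inj₁ (clique-index i , clique-index j ,
      λ eq → T-not⁻ t (≡⇒≡ᵇ _ _ (trans (sym (FinP.toℕ-↑ˡ i b)) (trans eq (FinP.toℕ-↑ˡ j b))))))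

  KP-adj-path : ∀ i j → adj (KP a b) (a F.↑ʳ i) (a F.↑ʳ j) ≡ adj (P b) i j
  KP-adj-path i j = bool-ext to from
    where
    i′ = toℕ (a F.↑ʳ i)
    j′ = toℕ (a F.↑ʳ j)
    to : T (adjKP a i′ j′) → T (adj (P b) i j)
    to t with adjKP⁻ a i′ j′ t
    ... | inj₁ (i<a , _) = ⊥-elim (<⇒≱ i<a (path-index i))
    ... | inj₂ (d , _) = dist1⁺ _ _ (Adjacent-+⁻ a (subst₂ Adjacent (FinP.toℕ-↑ʳ a i) (FinP.toℕ-↑ʳ a j) d))
    from : T (adj (P b) i j) → T (adjKP a i′ j′)
    from t = adjKP⁺ a i′ j′ (inj₂ (subst₂ Adjacent (sym (FinP.toℕ-↑ʳ a i)) (sym (FinP.toℕ-↑ʳ a j))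
      (Adjacent-+ a (dist1⁻ _ _ t)) , path-index i , path-index j))

  KP-no-bridge : ∀ i j → ¬ T (adj (KP a b) (i F.↑ˡ b) (a F.↑ʳ j)) × ¬ T (adj (KP a b) (a F.↑ʳ j) (i F.↑ˡ b))
  KP-no-bridge i j = to-path , from-path
    where
    to-path : ¬ T (adj (KP a b) (i F.↑ˡ b) (a F.↑ʳ j))
    to-path t with adjKP⁻ a _ _ t
    ... | inj₁ (_ , j<a , _) = <⇒≱ j<a (path-index j)
    ... | inj₂ (_ , a≤i , _) = <⇒≱ (clique-index i) a≤i
    from-path : ¬ T (adj (KP a b) (a F.↑ʳ j) (i F.↑ˡ b))
    from-path t with adjKP⁻ a _ _ t
    ... | inj₁ (j<a , _) = <⇒≱ j<a (path-index j)
    ... | inj₂ (_ , _ , a≤i) = <⇒≱ (clique-index i) a≤i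

block : ∀ {a b} (v : Fin (a + b)) → (Σ (Fin a) λ i → i F.↑ˡ b ≡ v) ⊎ (Σ (Fin b) λ j → a F.↑ʳ j ≡ v)
block {a} v with F.splitAt a v in eq
... | inj₁ i = inj₁ (i , FinP.splitAt⁻¹-↑ˡ eq)
... | inj₂ j = inj₂ (j , FinP.splitAt⁻¹-↑ʳ eq)

proper-KP-append : ∀ a b {k} (κ₁ : Fin a → Fin k) (κ₂ : Fin b → Fin k) →
  proper (KP a b) (append κ₁ κ₂) ≡ (proper (K a) κ₁ ∧ proper (P b) κ₂)
proper-KP-append a b κ₁ κ₂ = proper-ext (KP a b) κ to from
  where
  κ = append κ₁ κ₂
  to : Proper (KP a b) κ → T (proper (K a) κ₁ ∧ proper (P b) κ₂)
  to Pκ = T-∧⁺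
    (proper⁺ (K a) κ₁ λ u v t e → Pκ (u F.↑ˡ b) (v F.↑ˡ b) (subst T (sym (KP-adj-clique a b u v)) t)
      (trans (append-↑ˡ κ₁ κ₂ u) (trans e (sym (append-↑ˡ κ₁ κ₂ v)))))
    (proper⁺ (P b) κ₂ λ u v t e → Pκ (a F.↑ʳ u) (a F.↑ʳ v) (subst T (sym (KP-adj-path a b u v)) t)
      (trans (append-↑ʳ κ₁ κ₂ u) (trans e (sym (append-↑ʳ κ₁ κ₂ v)))))
  from : T (proper (K a) κ₁ ∧ proper (P b) κ₂) → Proper (KP a b) κ
  from t u v adjuv e with T-∧⁻ t | block {a} {b} u | block {a} {b} v
  ... | pK , _ | inj₁ (i , refl) | inj₁ (j , refl) = proper⁻ (K a) κ₁ pK i j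
          (subst T (KP-adj-clique a b i j) adjuv) (trans (sym (append-↑ˡ κ₁ κ₂ i)) (trans e (append-↑ˡ κ₁ κ₂ j)))
  ... | _ , pP | inj₂ (i , refl) | inj₂ (j , refl) = proper⁻ (P b) κ₂ pP i j
          (subst T (KP-adj-path a b i j) adjuv) (trans (sym (append-↑ʳ κ₁ κ₂ i)) (trans e (append-↑ʳ κ₁ κ₂ j)))
  ... | _ | inj₁ (i , refl) | inj₂ (j , refl) = proj₁ (KP-no-bridge a b i j) adjuv
  ... | _ | inj₂ (i , refl) | inj₁ (j , refl) = proj₂ (KP-no-bridge a b j i) adjuv

-- Counting form of  X_{K_a ⊔ P_b} = X_{K_a} X_{P_b}: a proper colouring of type α of the union is
-- a pair of proper colourings of the blocks whose types β and α - β add up to α.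
count-KP : ∀ a b k (α : Vector ℕ k) →
  count (KP a b) k α ≡ ∑ (below k α) (λ β → count (K a) k β * count (P b) k (λ j → α j ∸ β j))
count-KP a b k α = begin
    count (KP a b) k α
  ≡⟨ count-∑ (KP a b) k α ⟩
    ∑Col (a + b) k (λ κ → 𝟙 (proper (KP a b) κ ∧ hasType κ α))
  ≡⟨ ∑Col-append a b k _ ⟩
    ∑Col a k (λ κ₁ → ∑Col b k (λ κ₂ → 𝟙 (proper (KP a b) (append κ₁ κ₂) ∧ hasType (append κ₁ κ₂) α)))
  ≡⟨ ∑Col-cong a k (λ κ₁ → ∑Col-cong b k (λ κ₂ → split-type κ₁ κ₂)) ⟩
    ∑Col a k (λ κ₁ → ∑Col b k (λ κ₂ → ∑ (below k α) (λ β → χ₁ β κ₁ * χ₂ β κ₂)))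
  ≡⟨ ∑Col-cong a k (λ κ₁ → ∑-comm (allMaps b k) (below k α) _) ⟩
    ∑Col a k (λ κ₁ → ∑ (below k α) (λ β → ∑Col b k (λ κ₂ → χ₁ β κ₁ * χ₂ β κ₂)))
  ≡⟨ ∑-comm (allMaps a k) (below k α) _ ⟩
    ∑ (below k α) (λ β → ∑Col a k (λ κ₁ → ∑Col b k (λ κ₂ → χ₁ β κ₁ * χ₂ β κ₂)))
  ≡⟨ ∑-cong (below k α) (λ β →
       trans (∑Col-cong a k (λ κ₁ → ∑-*ˡ (allMaps b k) (χ₁ β κ₁) (χ₂ β))) (∑-*ʳ (allMaps a k) _ (χ₁ β))) ⟩
    ∑ (below k α) (λ β → ∑Col a k (χ₁ β) * ∑Col b k (χ₂ β))
  ≡⟨ ∑-cong (below k α) (λ β → cong₂ _*_ (count-∑ (K a) k β) (count-∑ (P b) k (λ j → α j ∸ β j))) ⟨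
    ∑ (below k α) (λ β → count (K a) k β * count (P b) k (λ j → α j ∸ β j))
  ∎
  where
  open ≡-Reasoning
  χ₁ : Vector ℕ k → (Fin a → Fin k) → ℕ
  χ₁ β κ₁ = 𝟙 (proper (K a) κ₁ ∧ hasType κ₁ β)
  χ₂ : Vector ℕ k → (Fin b → Fin k) → ℕ
  χ₂ β κ₂ = 𝟙 (proper (P b) κ₂ ∧ hasType κ₂ (λ j → α j ∸ β j))
  split-type : ∀ κ₁ κ₂ → 𝟙 (proper (KP a b) (append κ₁ κ₂) ∧ hasType (append κ₁ κ₂) α)
                         ≡ ∑ (below k α) (λ β → χ₁ β κ₁ * χ₂ β κ₂)
  split-type κ₁ κ₂ = begin
      𝟙 (proper (KP a b) (append κ₁ κ₂) ∧ hasType (append κ₁ κ₂) α)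
    ≡⟨ cong₂ (λ x y → 𝟙 (x ∧ y)) (proper-KP-append a b κ₁ κ₂)
         (allB-cong (λ j → cong (_≡ᵇ α j) (classSize-append κ₁ κ₂ j))) ⟩
      𝟙 ((pK ∧ pP) ∧ sameVec (λ j → classSize κ₁ j + classSize κ₂ j) α)
    ≡⟨ trans (𝟙-∧ (pK ∧ pP) type) (cong (_* 𝟙 type) (𝟙-∧ pK pP)) ⟩
      (𝟙 pK * 𝟙 pP) * 𝟙 (sameVec (λ j → classSize κ₁ j + classSize κ₂ j) α)
    ≡⟨ cong ((𝟙 pK * 𝟙 pP) *_) (below-convolution k α (classSize κ₁) (classSize κ₂)) ⟨
      (𝟙 pK * 𝟙 pP) * ∑ (below k α) (λ β → 𝟙 (hasType κ₁ β) * 𝟙 (hasType κ₂ (λ j → α j ∸ β j)))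
    ≡⟨ ∑-*ˡ (below k α) (𝟙 pK * 𝟙 pP) _ ⟨
      ∑ (below k α) (λ β → (𝟙 pK * 𝟙 pP) * (𝟙 (hasType κ₁ β) * 𝟙 (hasType κ₂ (λ j → α j ∸ β j))))
    ≡⟨ ∑-cong (below k α) (λ β → regroup pK pP (hasType κ₁ β) _) ⟩
      ∑ (below k α) (λ β → χ₁ β κ₁ * χ₂ β κ₂)
    ∎
    where
    pK = proper (K a) κ₁
    pP = proper (P b) κ₂
    type = sameVec (λ j → classSize κ₁ j + classSize κ₂ j) α
    regroup : ∀ x y x' y' → (𝟙 x * 𝟙 y) * (𝟙 x' * 𝟙 y') ≡ 𝟙 (x ∧ x') * 𝟙 (y ∧ y')
    regroup true true true true = refl
    regroup true true true false = refl
    regroup true true false y' = refl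
    regroup true false x' y' = sym (*-zeroʳ (𝟙 x'))
    regroup false y x' y' = refl

lollipopPath⇒tail⊎handle : ∀ m' i j → LollipopPathEdge (suc m') i j →
  TailEdge (suc m') i j ⊎ ((i ≡ m' × j ≡ suc m') ⊎ (i ≡ suc m' × j ≡ m'))
lollipopPath⇒tail⊎handle m' i j (d , nc) with i <? suc m' | j <? suc m'
... | yes i<m | yes j<m = ⊥-elim (nc (i<m , j<m))
... | no i≮m | no j≮m = inj₁ (d , ≮⇒≥ i≮m , ≮⇒≥ j≮m)
... | yes i<m | no j≮m = inj₂ (inj₁ (suc-injective (trans up j≡) , j≡))
  where
  up : suc i ≡ j
  up = [ id , (λ e → ⊥-elim (<⇒≱ i<m (≤-trans (≮⇒≥ j≮m) (≤-trans (n≤1+n j) (≤-reflexive e))))) ]′ d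
  j≡ : j ≡ suc m'
  j≡ = ≤-antisym (subst (_≤ suc m') up i<m) (≮⇒≥ j≮m)
... | no i≮m | yes j<m = inj₂ (inj₂ (i≡ , suc-injective (trans up i≡)))
  where
  up : suc j ≡ i
  up = [ (λ e → ⊥-elim (<⇒≱ j<m (≤-trans (≮⇒≥ i≮m) (≤-trans (n≤1+n i) (≤-reflexive e))))) , id ]′ d
  i≡ : i ≡ suc m'
  i≡ = ≤-antisym (subst (_≤ suc m') up j<m) (≮⇒≥ i≮m)

tail⇒lollipopPath : ∀ m i j → TailEdge m i j → LollipopPathEdge m i j
tail⇒lollipopPath m i j (d , m≤i , _) = d , λ (i<m , _) → <⇒≱ i<m m≤i

-- A tail edge of K_m ⊔ P_b is not inside {0..m}, since {m-1, m} is not a tail edge.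
tail⇒lollipopPath-suc : ∀ m i j → TailEdge m i j → LollipopPathEdge (suc m) i j
tail⇒lollipopPath-suc m i j (d , m≤i , m≤j) = d , λ (i<m+1 , j<m+1) →
  Adjacent-irrefl (subst₂ Adjacent (≤-antisym (≤-pred i<m+1) m≤i) (≤-antisym (≤-pred j<m+1) m≤j) d)

lollipopPath-suc⇒tail : ∀ m i j → LollipopPathEdge (suc m) i j → TailEdge m i j
lollipopPath-suc⇒tail m i j (d , nc) = d , m≤i , m≤j
  where
  m≤i : m ≤ i
  m≤i = ≮⇒≥ (λ i<m → nc (m<n⇒m<1+n i<m , s≤s (≤-trans (Adjacent-≤ d) i<m)))
  m≤j : m ≤ j
  m≤j = ≮⇒≥ (λ j<m → nc (s≤s (≤-trans (Adjacent-≤ (Adjacent-sym d)) j<m) , m<n⇒m<1+n j<m))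

clique-suc⇒clique⊎spoke : ∀ m i j → CliqueEdge (suc m) i j →
  CliqueEdge m i j ⊎ ((i ≡ m × j < m) ⊎ (j ≡ m × i < m))
clique-suc⇒clique⊎spoke m i j (i<m+1 , j<m+1 , i≢j) with m<1+n⇒m<n∨m≡n i<m+1 | m<1+n⇒m<n∨m≡n j<m+1
... | inj₁ i<m | inj₁ j<m = inj₁ (i<m , j<m , i≢j)
... | inj₂ refl | inj₁ j<m = inj₂ (inj₁ (refl , j<m))
... | inj₁ i<m | inj₂ refl = inj₂ (inj₂ (refl , i<m))
... | inj₂ refl | inj₂ refl = ⊥-elim (i≢j refl)

clique⇒clique-suc : ∀ m i j → CliqueEdge m i j → CliqueEdge (suc m) i j
clique⇒clique-suc m i j (i<m , j<m , i≢j) = m<n⇒m<1+n i<m , m<n⇒m<1+n j<m , i≢j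

adjKP-τ : ∀ m p i j → suc p < m → T (adjKP m i j) → T (adjKP m (τℕ p i) (τℕ p j))
adjKP-τ m p i j h t with adjKP⁻ m i j t
... | inj₁ (i<m , j<m , i≢j) = adjKP⁺ m _ _ (inj₁ (τℕ-< p i m h i<m , τℕ-< p j m h j<m ,
        λ e → i≢j (trans (sym (τℕ-involutive p i)) (trans (cong (τℕ p) e) (τℕ-involutive p j)))))
... | inj₂ (d , m≤i , m≤j)
  rewrite τℕ-fix p i (<-≤-trans h m≤i) | τℕ-fix p j (<-≤-trans h m≤j) = adjKP⁺ m i j (inj₂ (d , m≤i , m≤j))

proper-KP-τ : ∀ m b {k} r → suc r < m → (κ : Fin (m + b) → Fin k) → proper (KP m b) (κ ∘ τ r) ≡ proper (KP m b) κ
proper-KP-τ m b r h κ = bool-ext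
  (λ t → subst T (proper-cong (KP m b) (λ x → cong κ (τ-involutive r x)))
                 (proper⁺ (KP m b) _ (automorphism (κ ∘ τ r) (proper⁻ (KP m b) (κ ∘ τ r) t))))
  (λ t → proper⁺ (KP m b) (κ ∘ τ r) (automorphism κ (proper⁻ (KP m b) κ t)))
  where
  r+1<N : suc r < m + b
  r+1<N = <-≤-trans h (m≤m+n m b)
  automorphism : ∀ κ → Proper (KP m b) κ → Proper (KP m b) (κ ∘ τ r)
  automorphism κ Pκ u v t = Pκ (τ r u) (τ r v)
    (subst₂ (λ x y → T (adjKP m x y)) (sym (toℕ-τ r u r+1<N)) (sym (toℕ-τ r v r+1<N)) (adjKP-τ m r _ _ h t))

hasType-τ : ∀ {N k} r (κ : Fin N → Fin k) α → hasType (κ ∘ τ r) α ≡ hasType κ α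
hasType-τ {N} r κ α = allB-cong (λ j → cong (_≡ᵇ α j)
  (trans (classSize-∑ (κ ∘ τ r) j) (trans (∑Fin-τ N r _) (sym (classSize-∑ κ j)))))

module LollipopRecurrence (k : ℕ) (α : Vector ℕ k) (m' n : ℕ) where
  m NN : ℕ
  m = suc m'
  NN = m + suc n

  D : Graph
  D = KP m (suc n)

  vertex : ∀ r → r ≤ m → Fin NN
  vertex r h = F.fromℕ< (≤-<-trans h (m<m+n m (s≤s z≤n)))

  toℕ-vertex : ∀ r h → toℕ (vertex r h) ≡ r
  toℕ-vertex r h = FinP.toℕ-fromℕ< _

  vertex-≡ : ∀ {u r} h → toℕ u ≡ r → u ≡ vertex r h
  vertex-≡ {r = r} h e = FinP.toℕ-injective (trans e (sym (toℕ-vertex r h)))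

  w : Fin NN
  w = vertex m ≤-refl

  sharesColour : Fin NN → (Fin NN → Fin k) → Bool
  sharesColour u κ = ⌊ κ u FinP.≟ κ w ⌋

  ok : (Fin NN → Fin k) → Bool
  ok κ = proper D κ ∧ hasType κ α

  avoids : ℕ → (Fin NN → Fin k) → Bool
  avoids r κ = allB (λ u → not (toℕ u <ᵇ r) ∨ not (sharesColour u κ))

  avoids⁻ : ∀ r κ → T (avoids r κ) → ∀ u → toℕ u < r → κ u ≢ κ w
  avoids⁻ r κ t u u<r e with T-∨⁻ (allB⁻ _ t u)
  ... | inj₁ u≮r = T-not⁻ u≮r (<⇒<ᵇ u<r)
  ... | inj₂ ne = T-not⁻ ne (fromWitness e)

  avoids⁺ : ∀ r κ → (∀ u → toℕ u < r → κ u ≢ κ w) → T (avoids r κ)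
  avoids⁺ r κ f = allB⁺ _ each
    where
    each : ∀ u → T (not (toℕ u <ᵇ r) ∨ not (sharesColour u κ))
    each u with toℕ u <? r
    ... | yes u<r = T-∨ʳ {not (toℕ u <ᵇ r)} (T-not (λ t → f u u<r (toWitness t)))
    ... | no u≮r = T-∨ˡ (T-not (λ t → u≮r (<ᵇ⇒< _ _ t)))

  proper-handle : ∀ κ → proper (L m (suc n)) κ ≡ (proper D κ ∧ not (sharesColour (vertex m' (n≤1+n m')) κ))
  proper-handle κ = proper-ext (L m (suc n)) κ to from
    where
    v₀ = vertex m' (n≤1+n m')
    D⇒L : ∀ i j → T (adjKP m i j) → T (adjLollipop m i j)
    D⇒L i j t = adjLollipop⁺ m i j ([ inj₁ , inj₂ ∘ tail⇒lollipopPath m i j ]′ (adjKP⁻ m i j t))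
    handle : T (adjLollipop m (toℕ v₀) (toℕ w))
    handle = subst₂ (λ x y → T (adjLollipop m x y)) (sym (toℕ-vertex m' (n≤1+n m'))) (sym (toℕ-vertex m ≤-refl))
      (adjLollipop⁺ m m' m (inj₂ (inj₁ refl , λ (_ , m<m) → <-irrefl refl m<m)))
    to : Proper (L m (suc n)) κ → T (proper D κ ∧ not (sharesColour v₀ κ))
    to Pκ = T-∧⁺ (proper⁺ D κ (λ u v t → Pκ u v (D⇒L (toℕ u) (toℕ v) t))) (T-not (λ t → Pκ v₀ w handle (toWitness t)))
    from : T (proper D κ ∧ not (sharesColour v₀ κ)) → Proper (L m (suc n)) κ
    from t u v a with T-∧⁻ t | adjLollipop⁻ m (toℕ u) (toℕ v) a
    ... | pD , _ | inj₁ c = proper⁻ D κ pD u v (adjKP⁺ m (toℕ u) (toℕ v) (inj₁ c))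
    ... | pD , nh | inj₂ p with lollipopPath⇒tail⊎handle m' (toℕ u) (toℕ v) p
    ...   | inj₁ tail = proper⁻ D κ pD u v (adjKP⁺ m (toℕ u) (toℕ v) (inj₂ tail))
    ...   | inj₂ (inj₁ (u≡ , v≡)) = λ e → T-not⁻ nh (fromWitness
            (subst₂ (λ x y → κ x ≡ κ y) (vertex-≡ (n≤1+n m') u≡) (vertex-≡ ≤-refl v≡) e))
    ...   | inj₂ (inj₂ (u≡ , v≡)) = λ e → T-not⁻ nh (fromWitness
            (sym (subst₂ (λ x y → κ x ≡ κ y) (vertex-≡ ≤-refl u≡) (vertex-≡ (n≤1+n m') v≡) e)))

  proper-spokes : ∀ κ → proper (Lollipop (suc m) NN) κ ≡ (proper D κ ∧ avoids m κ)
  proper-spokes κ = proper-ext (Lollipop (suc m) NN) κ to from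
    where
    D⇒L : ∀ i j → T (adjKP m i j) → T (adjLollipop (suc m) i j)
    D⇒L i j t = adjLollipop⁺ (suc m) i j
      ([ inj₁ ∘ clique⇒clique-suc m i j , inj₂ ∘ tail⇒lollipopPath-suc m i j ]′ (adjKP⁻ m i j t))
    spoke : ∀ u → toℕ u < m → T (adjLollipop (suc m) (toℕ u) (toℕ w))
    spoke u u<m = subst (λ y → T (adjLollipop (suc m) (toℕ u) y)) (sym (toℕ-vertex m ≤-refl))
      (adjLollipop⁺ (suc m) (toℕ u) m (inj₁ (m<n⇒m<1+n u<m , n<1+n m , <⇒≢ u<m)))
    to : Proper (Lollipop (suc m) NN) κ → T (proper D κ ∧ avoids m κ)
    to Pκ = T-∧⁺ (proper⁺ D κ (λ u v t → Pκ u v (D⇒L (toℕ u) (toℕ v) t))) (avoids⁺ m κ (λ u u<m → Pκ u w (spoke u u<m)))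
    from : T (proper D κ ∧ avoids m κ) → Proper (Lollipop (suc m) NN) κ
    from t u v a with T-∧⁻ t | adjLollipop⁻ (suc m) (toℕ u) (toℕ v) a
    ... | pD , _ | inj₂ p = proper⁻ D κ pD u v (adjKP⁺ m (toℕ u) (toℕ v) (inj₂ (lollipopPath-suc⇒tail m (toℕ u) (toℕ v) p)))
    ... | pD , av | inj₁ c with clique-suc⇒clique⊎spoke m (toℕ u) (toℕ v) c
    ...   | inj₁ c' = proper⁻ D κ pD u v (adjKP⁺ m (toℕ u) (toℕ v) (inj₁ c'))
    ...   | inj₂ (inj₁ (u≡ , v<m)) = λ e → avoids⁻ m κ av v v<m (trans (sym e) (cong κ (vertex-≡ ≤-refl u≡)))
    ...   | inj₂ (inj₂ (v≡ , u<m)) = λ e → avoids⁻ m κ av u u<m (trans e (cong κ (vertex-≡ ≤-refl v≡)))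

  C : ℕ → ℕ
  C r = ∑Col NN k (λ κ → 𝟙 (ok κ ∧ avoids r κ))

  E : ∀ r → r < m → ℕ
  E r h = ∑Col NN k (λ κ → 𝟙 (ok κ ∧ sharesColour (vertex r (<⇒≤ h)) κ))

  avoids-suc : ∀ r (h : r < m) κ → avoids (suc r) κ ≡ (avoids r κ ∧ not (sharesColour (vertex r (<⇒≤ h)) κ))
  avoids-suc r h κ = bool-ext to from
    where
    vᵣ = vertex r (<⇒≤ h)
    to : T (avoids (suc r) κ) → T (avoids r κ ∧ not (sharesColour vᵣ κ))
    to t = T-∧⁺ (avoids⁺ r κ (λ u u<r → avoids⁻ (suc r) κ t u (m<n⇒m<1+n u<r)))
                (T-not (λ s → avoids⁻ (suc r) κ t vᵣ (subst (_< suc r) (sym (toℕ-vertex r (<⇒≤ h))) (n<1+n r)) (toWitness s)))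
    from : T (avoids r κ ∧ not (sharesColour vᵣ κ)) → T (avoids (suc r) κ)
    from t = avoids⁺ (suc r) κ below-suc
      where
      below-suc : ∀ u → toℕ u < suc r → κ u ≢ κ w
      below-suc u u<r+1 with m<1+n⇒m<n∨m≡n u<r+1 | T-∧⁻ t
      ... | inj₁ u<r | av , _ = avoids⁻ r κ av u u<r
      ... | inj₂ u≡r | _ , ns = λ e → T-not⁻ ns (fromWitness (subst (λ x → κ x ≡ κ w) (vertex-≡ (<⇒≤ h) u≡r) e))

  -- Clique vertices get distinct colours, so if vertex r shares w's colour, no vertex below r does.
  shared⇒avoids : ∀ r (h : r < m) κ → T (ok κ) → T (sharesColour (vertex r (<⇒≤ h)) κ) → T (avoids r κ)
  shared⇒avoids r h κ okκ s = avoids⁺ r κ (λ u u<r e →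
    proper⁻ D κ (proj₁ (T-∧⁻ okκ)) u vᵣ (clique-edge u u<r) (trans e (sym (toWitness s))))
    where
    vᵣ = vertex r (<⇒≤ h)
    clique-edge : ∀ u → toℕ u < r → T (adjKP m (toℕ u) (toℕ vᵣ))
    clique-edge u u<r = subst (λ y → T (adjKP m (toℕ u) y)) (sym (toℕ-vertex r (<⇒≤ h)))
      (adjKP⁺ m (toℕ u) r (inj₁ (<-trans u<r h , h , <⇒≢ u<r)))

  C-step : ∀ r (h : r < m) → C r ≡ C (suc r) + E r h
  C-step r h = trans (∑Col-cong NN k split) (∑-+ (allMaps NN k) _ _)
    where
    split : ∀ κ → 𝟙 (ok κ ∧ avoids r κ)
                ≡ 𝟙 (ok κ ∧ avoids (suc r) κ) + 𝟙 (ok κ ∧ sharesColour (vertex r (<⇒≤ h)) κ)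
    split κ rewrite avoids-suc r h κ = 𝟙-split-forced (ok κ) (avoids r κ) _ (shared⇒avoids r h κ)

  -- Exchanging the clique vertices r and r + 1 is an automorphism of D fixing w, so E r = E (r + 1).
  E-τ : ∀ r (h : suc r < m) → E r (<-trans (n<1+n r) h) ≡ E (suc r) h
  E-τ r h = trans (∑Col-cong NN k relabel) (∑Col-τ NN k r F F-ext)
    where
    r+1<NN : suc r < NN
    r+1<NN = <-≤-trans h (m≤m+n m (suc n))
    vᵣ vᵣ₊₁ : Fin NN
    vᵣ = vertex r (<⇒≤ (<-trans (n<1+n r) h))
    vᵣ₊₁ = vertex (suc r) (<⇒≤ h)
    F : (Fin NN → Fin k) → ℕ
    F κ = 𝟙 (ok κ ∧ sharesColour vᵣ₊₁ κ)
    F-ext : Extensional F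
    F-ext κ κ' e = cong₂ (λ a b → 𝟙 (a ∧ b)) (cong₂ _∧_ (proper-cong D e) (hasType-cong e α))
                                             (cong₂ (λ a b → ⌊ a FinP.≟ b ⌋) (e vᵣ₊₁) (e w))
    τ-fixes-w : τ r w ≡ w
    τ-fixes-w = vertex-≡ ≤-refl (trans (toℕ-τ r w r+1<NN) (trans (cong (τℕ r) (toℕ-vertex m ≤-refl)) (τℕ-fix r m h)))
    τ-moves-vᵣ₊₁ : τ r vᵣ₊₁ ≡ vᵣ
    τ-moves-vᵣ₊₁ = vertex-≡ (<⇒≤ (<-trans (n<1+n r) h))
      (trans (toℕ-τ r vᵣ₊₁ r+1<NN) (trans (cong (τℕ r) (toℕ-vertex (suc r) (<⇒≤ h))) (τℕ-p r)))
    relabel : ∀ κ → 𝟙 (ok κ ∧ sharesColour vᵣ κ) ≡ F (κ ∘ τ r)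
    relabel κ = sym (cong₂ (λ a b → 𝟙 (a ∧ b)) (cong₂ _∧_ (proper-KP-τ m (suc n) r h κ) (hasType-τ r κ α))
                                                (cong₂ (λ a b → ⌊ κ a FinP.≟ κ b ⌋) τ-moves-vᵣ₊₁ τ-fixes-w))

  E₀ : ℕ
  E₀ = E 0 (s≤s z≤n)

  E-const : ∀ r (h : r < m) → E r h ≡ E₀
  E-const zero h = refl
  E-const (suc r) h = trans (sym (E-τ r h)) (E-const r (<-trans (n<1+n r) h))

  C-telescope : ∀ r → r ≤ m → C 0 ≡ C r + r * E₀
  C-telescope zero _ = sym (+-identityʳ _)
  C-telescope (suc r) h = begin
    C 0                      ≡⟨ C-telescope r (<⇒≤ h) ⟩
    C r + r * E₀             ≡⟨ cong (_+ r * E₀) (C-step r h) ⟩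
    C (suc r) + E r h + r * E₀ ≡⟨ cong (λ x → C (suc r) + x + r * E₀) (E-const r h) ⟩
    C (suc r) + E₀ + r * E₀  ≡⟨ +-assoc (C (suc r)) E₀ (r * E₀) ⟩
    C (suc r) + suc r * E₀   ∎
    where open ≡-Reasoning

  C₀ : C 0 ≡ count D k α
  C₀ = trans (∑Col-cong NN k (λ κ → cong 𝟙 (trans (cong (ok κ ∧_) (nothing-below-0 κ)) (∧-identityʳ (ok κ)))))
             (sym (count-∑ D k α))
    where
    nothing-below-0 : ∀ κ → avoids 0 κ ≡ true
    nothing-below-0 κ = bool-ext (λ _ → tt) (λ _ → avoids⁺ 0 κ (λ _ ()))

  count-D-handle : count D k α ≡ count (L m (suc n)) k α + E₀
  count-D-handle = begin
    count D k α
      ≡⟨ count-∑ D k α ⟩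
    ∑Col NN k (λ κ → 𝟙 (ok κ))
      ≡⟨ ∑Col-cong NN k (λ κ → 𝟙-split (ok κ) (sharesColour v₀ κ)) ⟩
    ∑Col NN k (λ κ → 𝟙 (ok κ ∧ not (sharesColour v₀ κ)) + 𝟙 (ok κ ∧ sharesColour v₀ κ))
      ≡⟨ ∑-+ (allMaps NN k) _ _ ⟩
    ∑Col NN k (λ κ → 𝟙 (ok κ ∧ not (sharesColour v₀ κ))) + E m' (n<1+n m')
      ≡⟨ cong₂ _+_ (sym (trans (count-∑ (L m (suc n)) k α) (∑Col-cong NN k lollipop))) (E-const m' (n<1+n m')) ⟩
    count (L m (suc n)) k α + E₀
      ∎
    where
    open ≡-Reasoning
    v₀ = vertex m' (n≤1+n m')
    lollipop : ∀ κ → 𝟙 (proper (L m (suc n)) κ ∧ hasType κ α) ≡ 𝟙 (ok κ ∧ not (sharesColour v₀ κ))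
    lollipop κ = cong 𝟙 (trans (cong (_∧ hasType κ α) (proper-handle κ)) (∧-swapʳ (proper D κ) _ _))

  count-D-spokes : count D k α ≡ count (L (suc m) n) k α + m * E₀
  count-D-spokes = begin
    count D k α                         ≡⟨ C₀ ⟨
    C 0                                 ≡⟨ C-telescope m ≤-refl ⟩
    C m + m * E₀                        ≡⟨ cong (_+ m * E₀) lollipop ⟩
    count (L (suc m) n) k α + m * E₀    ∎
    where
    open ≡-Reasoning
    -- L (suc m) n has  suc m + n  vertices, the same number as D
    count-Lollipop : ℕ → ℕ
    count-Lollipop N = count (Lollipop (suc m) N) k α
    lollipop : C m ≡ count (L (suc m) n) k α
    lollipop = begin
      C m                       ≡⟨ ∑Col-cong NN k (λ κ → cong 𝟙 (sym (trans (cong (_∧ hasType κ α) (proper-spokes κ))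
                                                                              (∧-swapʳ (proper D κ) _ _)))) ⟩
      ∑Col NN k (λ κ → 𝟙 (proper (Lollipop (suc m) NN) κ ∧ hasType κ α)) ≡⟨ count-∑ (Lollipop (suc m) NN) k α ⟨
      count-Lollipop (m + suc n)  ≡⟨ cong count-Lollipop (+-suc m n) ⟩
      count-Lollipop (suc m + n) ∎

  recurrence : m * count (L m (suc n)) k α ≡ m' * count D k α + count (L (suc m) n) k α
  recurrence = +-cancelʳ-≡ (m * E₀) _ _ (begin
    m * ℓ + m * E₀           ≡⟨ *-distribˡ-+ m ℓ E₀ ⟨
    m * (ℓ + E₀)             ≡⟨ cong (m *_) count-D-handle ⟨
    d + m' * d               ≡⟨ cong (_+ m' * d) count-D-spokes ⟩
    ℓ' + m * E₀ + m' * d     ≡⟨ rearrange ℓ' (m * E₀) (m' * d) ⟩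
    m' * d + ℓ' + m * E₀     ∎)
    where
    open ≡-Reasoning
    ℓ = count (L m (suc n)) k α
    ℓ' = count (L (suc m) n) k α
    d = count D k α
    rearrange : ∀ x y z → x + y + z ≡ z + x + y
    rearrange x y z = trans (+-assoc x y z) (trans (cong (x +_) (+-comm y z))
                        (trans (sym (+-assoc x z y)) (cong (_+ y) (+-comm x z))))

ι : ℕ → ℚ
ι a = frac a 1

frac-ᵘ : ∀ a b → toℚᵘ (frac a (suc b)) ℚᵘ.≃ mkℚᵘ (ℤ.+ a) b
frac-ᵘ a b = ℚP.toℚᵘ-fromℚᵘ (mkℚᵘ (ℤ.+ a) b)

ι-+ : ∀ a b → ι (a + b) ≡ ι a ℚ.+ ι b
ι-+ a b = ℚP.toℚᵘ-injective (ℚᵘP.≃-trans (frac-ᵘ (a + b) 0) (ℚᵘP.≃-trans sum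
  (ℚᵘP.≃-sym (ℚᵘP.≃-trans (ℚP.toℚᵘ-homo-+ (ι a) (ι b)) (ℚᵘP.+-cong (frac-ᵘ a 0) (frac-ᵘ b 0))))))
  where
  sum : mkℚᵘ (ℤ.+ (a + b)) 0 ℚᵘ.≃ mkℚᵘ (ℤ.+ a) 0 ℚᵘ.+ mkℚᵘ (ℤ.+ b) 0
  sum = *≡* (cong (ℤ._* ℤ.+ 1) (trans (ℤP.pos-+ a b) (sym (cong₂ ℤ._+_ (ℤP.*-identityʳ (ℤ.+ a)) (ℤP.*-identityʳ (ℤ.+ b))))))

frac-* : ∀ a b c d .{{_ : NonZero b}} .{{_ : NonZero d}} → frac a b ℚ.* frac c d ≡ frac (a * c) (b * d)
frac-* a (suc b) c (suc d) = ℚP.toℚᵘ-injective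
  (ℚᵘP.≃-trans (ℚP.toℚᵘ-homo-* (frac a (suc b)) (frac c (suc d)))
  (ℚᵘP.≃-trans (ℚᵘP.*-cong (frac-ᵘ a b) (frac-ᵘ c d))
  (ℚᵘP.≃-trans (*≡* (cong (ℤ._* ℤ.+ suc (d + b * suc d)) (sym (ℤP.pos-* a c)))) (ℚᵘP.≃-sym (frac-ᵘ (a * c) _)))))

ι-* : ∀ a b → ι (a * b) ≡ ι a ℚ.* ι b
ι-* a b = sym (frac-* a 1 b 1)

frac-≡ : ∀ a b c d .{{_ : NonZero b}} .{{_ : NonZero d}} → a * d ≡ c * b → frac a b ≡ frac c d
frac-≡ a (suc b) c (suc d) e = ℚP.toℚᵘ-injective (ℚᵘP.≃-trans (frac-ᵘ a b)
  (ℚᵘP.≃-trans (*≡* (trans (sym (ℤP.pos-* a (suc d))) (trans (cong ℤ.+_ e) (ℤP.pos-* c (suc b)))))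
  (ℚᵘP.≃-sym (frac-ᵘ c d))))

frac-÷ : ∀ m a b .{{_ : NonZero m}} .{{_ : NonZero b}} → frac 1 m ℚ.* frac a b ≡ frac a (m * b)
frac-÷ m a b = trans (frac-* 1 m a b)
  (frac-≡ (1 * a) (m * b) a (m * b) {{m*n≢0 m b}} {{m*n≢0 m b}} (cong (_* (m * b)) (*-identityˡ a)))

solve-* : ∀ m {x y} .{{_ : NonZero m}} → ι m ℚ.* x ≡ y → x ≡ frac 1 m ℚ.* y
solve-* m {x} {y} e = begin
  x                            ≡⟨ ℚP.*-identityˡ x ⟨
  1ℚ ℚ.* x                      ≡⟨ cong (ℚ._* x) inverse ⟨
  (frac 1 m ℚ.* ι m) ℚ.* x      ≡⟨ ℚP.*-assoc (frac 1 m) (ι m) x ⟩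
  frac 1 m ℚ.* (ι m ℚ.* x)      ≡⟨ cong (frac 1 m ℚ.*_) e ⟩
  frac 1 m ℚ.* y                ∎
  where
  open ≡-Reasoning
  inverse : frac 1 m ℚ.* ι m ≡ 1ℚ
  inverse = trans (frac-÷ m m 1) (frac-≡ m (m * 1) 1 1 {{m*n≢0 m 1}} (sym (*-identityˡ (m * 1))))

Σ<-cong : ∀ {k} n {F G : ℕ → Series k} α → (∀ i → F i α ≡ G i α) → Σ< n F α ≡ Σ< n G α
Σ<-cong zero α e = refl
Σ<-cong (suc n) α e = cong₂ ℚ._+_ (Σ<-cong n α e) (e n)

Σ<-shift : ∀ {k} n (F : ℕ → Series k) α → Σ< (suc n) F α ≡ F 0 α ℚ.+ Σ< n (F ∘ suc) α
Σ<-shift zero F α = trans (ℚP.+-identityˡ (F 0 α)) (sym (ℚP.+-identityʳ (F 0 α)))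
Σ<-shift (suc n) F α = trans (cong (ℚ._+ F (suc n) α) (Σ<-shift n F α)) (ℚP.+-assoc (F 0 α) _ _)

Σ<-scale : ∀ {k} n c (F : ℕ → Series k) α → Σ< n (λ i → c ⊙ F i) α ≡ c ℚ.* Σ< n F α
Σ<-scale zero c F α = sym (ℚP.*-zeroʳ c)
Σ<-scale (suc n) c F α = trans (cong (ℚ._+ c ℚ.* F n α) (Σ<-scale n c F α)) (sym (ℚP.*-distribˡ-+ c _ _))

product-KP : ∀ a b k α → (X (K a) k ⊛ X (P b) k) α ≡ ι (count (KP a b) k α)
product-KP a b k α =
  trans (sum-ι (below k α) (count (K a) k) (λ β → count (P b) k (λ j → α j ∸ β j))) (cong ι (sym (count-KP a b k α)))
  where
  sum-ι : ∀ {A : Set} (xs : List A) (f g : A → ℕ) →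
    sumℚ (map (λ x → ι (f x) ℚ.* ι (g x)) xs) ≡ ι (∑ xs (λ x → f x * g x))
  sum-ι [] f g = refl
  sum-ι (x ∷ xs) f g = sym (trans (ι-+ (f x * g x) _) (cong₂ ℚ._+_ (ι-* (f x) (g x)) (sym (sum-ι xs f g))))

count-L-0 : ∀ m k α → count (L m 0) k α ≡ count (K (m + 0)) k α
count-L-0 m k α = trans (count-∑ (L m 0) k α)
  (trans (∑Col-cong (m + 0) k (λ κ → cong (λ b → 𝟙 (b ∧ hasType κ α)) (same-edges κ))) (sym (count-∑ (K (m + 0)) k α)))
  where
  in-clique : (u : Fin (m + 0)) → toℕ u < m
  in-clique u = subst (toℕ u <_) (+-identityʳ m) (FinP.toℕ<n u)
  same-edges : ∀ κ → proper (L m 0) κ ≡ proper (K (m + 0)) κ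
  same-edges κ = proper-ext (L m 0) κ
    (λ Pκ → proper⁺ (K (m + 0)) κ (λ u v t → Pκ u v
       (adjLollipop⁺ m (toℕ u) (toℕ v) (inj₁ (in-clique u , in-clique v , λ e → T-not⁻ t (≡⇒≡ᵇ _ _ e))))))
    (λ t u v a → case-edge t u v (adjLollipop⁻ m (toℕ u) (toℕ v) a))
    where
    case-edge : T (proper (K (m + 0)) κ) → ∀ u v →
      CliqueEdge m (toℕ u) (toℕ v) ⊎ LollipopPathEdge m (toℕ u) (toℕ v) → κ u ≢ κ v
    case-edge t u v (inj₁ (_ , _ , ne)) = proper⁻ (K (m + 0)) κ t u v (T-not (λ x → ne (≡ᵇ⇒≡ _ _ x)))
    case-edge t u v (inj₂ (_ , nc)) = ⊥-elim (nc (in-clique u , in-clique v))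

recurrence-ℚ : ∀ k α m' n →
  ι (suc m') ℚ.* X (L (suc m') (suc n)) k α
    ≡ ι m' ℚ.* (X (K (suc m' + 0)) k ⊛ X (P (suc n)) k) α ℚ.+ X (L (suc (suc m')) n) k α
recurrence-ℚ k α m' n = begin
  ι m ℚ.* ι (count (L m (suc n)) k α)       ≡⟨ ι-* m (count (L m (suc n)) k α) ⟨
  ι (m * count (L m (suc n)) k α)           ≡⟨ cong ι (recurrence k α m' n) ⟩
  ι (m' * count D k α + ℓ')                 ≡⟨ ι-+ (m' * count D k α) ℓ' ⟩
  ι (m' * count D k α) ℚ.+ ι ℓ'             ≡⟨ cong (ℚ._+ ι ℓ') (ι-* m' (count D k α)) ⟩
  ι m' ℚ.* ι (count D k α) ℚ.+ ι ℓ'         ≡⟨ cong (λ t → ι m' ℚ.* t ℚ.+ ι ℓ') product ⟩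
  ι m' ℚ.* (X (K (m + 0)) k ⊛ X (P (suc n)) k) α ℚ.+ ι ℓ' ∎
  where
  open ≡-Reasoning
  open LollipopRecurrence using (recurrence)
  m = suc m'
  D = KP m (suc n)
  ℓ' = count (L (suc m) n) k α
  product : ι (count D k α) ≡ (X (K (m + 0)) k ⊛ X (P (suc n)) k) α
  product = trans (sym (product-KP m (suc n) k α)) (cong (λ a → (X (K a) k ⊛ X (P (suc n)) k) α) (sym (+-identityʳ m)))

frac-cancel : ∀ c a b .{{_ : NonZero c}} .{{_ : NonZero b}} → frac (c * a) (c * b) ≡ frac a b
frac-cancel c a b = frac-≡ (c * a) (c * b) a b {{m*n≢0 c b}} (trans (cong (_* b) (*-comm c a)) (*-assoc a c b))

rising-nonZero : ∀ m' i → NonZero (rising (suc m') i)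
rising-nonZero m' zero = _
rising-nonZero m' (suc i) = m*n≢0 (rising (suc m') i) (suc m' + suc i) {{rising-nonZero m' i}}

rising-suc : ∀ m i → rising m (suc i) ≡ m * rising (suc m) i
rising-suc m zero = cong (m *_) (+-comm m 1)
rising-suc m (suc i) = begin
  rising m (suc i) * (m + suc (suc i))       ≡⟨ cong₂ _*_ (rising-suc m i) (+-suc m (suc i)) ⟩
  m * rising (suc m) i * (suc m + suc i)     ≡⟨ *-assoc m _ _ ⟩
  m * (rising (suc m) i * (suc m + suc i))   ∎
  where open ≡-Reasoning

-- Dividing by m turns the coefficients of the formula for (m+1, n) into those for (m, n+1).
coeff-K : ∀ m' n → frac 1 (suc m') ℚ.* frac (suc m' !) ((suc m' + n) !) ≡ frac (m' !) ((m' + suc n) !)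
coeff-K m' n = begin
  frac 1 m ℚ.* frac (m * m' !) ((m + n) !)   ≡⟨ frac-÷ m (m * m' !) ((m + n) !) {{_}} {{(m + n) !≢0}} ⟩
  frac (m * m' !) (m * (m + n) !)            ≡⟨ frac-cancel m (m' !) ((m + n) !) {{_}} {{(m + n) !≢0}} ⟩
  frac (m' !) ((m + n) !)                    ≡⟨ cong (λ t → frac (m' !) (t !)) (+-suc m' n) ⟨
  frac (m' !) ((m' + suc n) !)               ∎
  where
  open ≡-Reasoning
  m = suc m'

coeff-0 : ∀ m' → frac 1 (suc m') ℚ.* ι m' ≡ frac (m' + 0) (rising (suc m') 0)
coeff-0 m' = trans (frac-÷ (suc m') m' 1) (cong₂ frac (sym (+-identityʳ m')) (*-identityʳ (suc m')))

coeff-suc : ∀ m' i → frac 1 (suc m') ℚ.* frac (suc m' + i) (rising (suc (suc m')) i)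
                     ≡ frac (m' + suc i) (rising (suc m') (suc i))
coeff-suc m' i = trans (frac-÷ m (m + i) (rising (suc m) i) {{_}} {{rising-nonZero m i}})
                       (cong₂ frac (sym (+-suc m' i)) (sym (rising-suc m i)))
  where m = suc m'

lollipopRHS : ℕ → ℕ → (k : ℕ) → Series k
lollipopRHS m n k = frac ((m ∸ 1) !) ((m + n ∸ 1) !) ⊙ X (K (m + n)) k
                  ⊕ Σ< n (λ i → frac (m + i ∸ 1) (rising m i) ⊙ (X (K (m + i)) k ⊛ X (P (n ∸ i)) k))

rhs-step : ∀ k α m' n → let m = suc m' in
  frac 1 m ℚ.* (ι m' ℚ.* (X (K (m + 0)) k ⊛ X (P (suc n)) k) α ℚ.+ lollipopRHS (suc m) n k α)
    ≡ lollipopRHS m (suc n) k α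
rhs-step k α m' n = begin
    u ℚ.* (ι m' ℚ.* Y 0 ℚ.+ (frac (m !) ((m + n) !) ℚ.* XK' ℚ.+ Σ< n F' α))
  ≡⟨ distribute u (ι m') (Y 0) (frac (m !) ((m + n) !)) XK' (Σ< n F' α) ⟩
    (u ℚ.* frac (m !) ((m + n) !)) ℚ.* XK' ℚ.+ ((u ℚ.* ι m') ℚ.* Y 0 ℚ.+ u ℚ.* Σ< n F' α)
  ≡⟨ cong₂ ℚ._+_ (cong₂ ℚ._*_ (coeff-K m' n) XK'≡XK)
                  (cong₂ ℚ._+_ (cong (ℚ._* Y 0) (coeff-0 m')) (sym (Σ<-scale n u F' α))) ⟩
    frac (m' !) ((m' + suc n) !) ℚ.* XK ℚ.+ (F 0 α ℚ.+ Σ< n (λ i → u ⊙ F' i) α)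
  ≡⟨ cong (λ t → frac (m' !) ((m' + suc n) !) ℚ.* XK ℚ.+ (F 0 α ℚ.+ t)) (Σ<-cong n α shifted) ⟩
    frac (m' !) ((m' + suc n) !) ℚ.* XK ℚ.+ (F 0 α ℚ.+ Σ< n (F ∘ suc) α)
  ≡⟨ cong (frac (m' !) ((m' + suc n) !) ℚ.* XK ℚ.+_) (Σ<-shift n F α) ⟨
    frac (m' !) ((m' + suc n) !) ℚ.* XK ℚ.+ Σ< (suc n) F α
  ∎
  where
  open ≡-Reasoning
  m = suc m'
  u = frac 1 m
  XK = X (K (m + suc n)) k α
  XK' = X (K (suc m + n)) k α
  XK'≡XK : XK' ≡ XK
  XK'≡XK = cong (λ t → X (K t) k α) (sym (+-suc m n))
  Y : ℕ → ℚ
  Y i = (X (K (m + i)) k ⊛ X (P (suc n ∸ i)) k) α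
  F F' : ℕ → Series k
  F i = frac (m + i ∸ 1) (rising m i) ⊙ (X (K (m + i)) k ⊛ X (P (suc n ∸ i)) k)
  F' i = frac (m + i) (rising (suc m) i) ⊙ (X (K (suc m + i)) k ⊛ X (P (n ∸ i)) k)
  distribute : ∀ (u b y a x s : ℚ) →
    u ℚ.* (b ℚ.* y ℚ.+ (a ℚ.* x ℚ.+ s)) ≡ (u ℚ.* a) ℚ.* x ℚ.+ ((u ℚ.* b) ℚ.* y ℚ.+ u ℚ.* s)
  distribute = solve 6 (λ u b y a x s → u :* (b :* y :+ (a :* x :+ s)) := (u :* a) :* x :+ ((u :* b) :* y :+ u :* s)) refl
    where open +-*-Solver
  shifted : ∀ i → (u ⊙ F' i) α ≡ F (suc i) α
  shifted i = trans (sym (ℚP.*-assoc u _ _))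
    (cong₂ ℚ._*_ (coeff-suc m' i) (cong (λ t → (X (K t) k ⊛ X (P (n ∸ i)) k) α) (sym (+-suc m i))))

lollipop-formula : ∀ k α n m' → X (L (suc m') n) k α ≡ lollipopRHS (suc m') n k α
lollipop-formula k α zero m' = begin
  ι (count (L m 0) k α)                           ≡⟨ cong ι (count-L-0 m k α) ⟩
  X (K (m + 0)) k α                               ≡⟨ ℚP.*-identityˡ _ ⟨
  1ℚ ℚ.* X (K (m + 0)) k α                         ≡⟨ cong (ℚ._* X (K (m + 0)) k α) one ⟩
  frac (m' !) ((m' + 0) !) ℚ.* X (K (m + 0)) k α   ≡⟨ ℚP.+-identityʳ _ ⟨
  lollipopRHS m 0 k α                             ∎
  where
  open ≡-Reasoning
  m = suc m'
  one : 1ℚ ≡ frac (m' !) ((m' + 0) !)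
  one = frac-≡ 1 1 (m' !) ((m' + 0) !) {{_}} {{(m' + 0) !≢0}}
    (trans (*-identityˡ _) (trans (cong _! (+-identityʳ m')) (sym (*-identityʳ (m' !)))))
lollipop-formula k α (suc n) m' = begin
  X (L m (suc n)) k α
    ≡⟨ solve-* m (recurrence-ℚ k α m' n) ⟩
  frac 1 m ℚ.* (ι m' ℚ.* Y₀ ℚ.+ X (L (suc m) n) k α)
    ≡⟨ cong (λ t → frac 1 m ℚ.* (ι m' ℚ.* Y₀ ℚ.+ t)) (lollipop-formula k α n m) ⟩
  frac 1 m ℚ.* (ι m' ℚ.* Y₀ ℚ.+ lollipopRHS (suc m) n k α)
    ≡⟨ rhs-step k α m' n ⟩
  lollipopRHS m (suc n) k α
    ∎
  where
  open ≡-Reasoning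
  m = suc m'
  Y₀ = (X (K (m + 0)) k ⊛ X (P (suc n)) k) α

-- Proposition 3.5: the formula holds already for m ≥ 1, hence in particular for m ≥ 2.
proposition3p5 : (m n : ℕ) → 2 ≤ m → (k : ℕ) → (α : Vector ℕ k) →
    X (L m n) k α
      ≡ (frac ((m ∸ 1) !) ((m + n ∸ 1) !) ⊙ X (K (m + n)) k
         ⊕ Σ< n (λ i → frac (m + i ∸ 1) (rising m i) ⊙ (X (K (m + i)) k ⊛ X (P (n ∸ i)) k))) α
proposition3p5 zero n () k α
proposition3p5 (suc m') n _ k α = lollipop-formula k α n m'
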